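{- For all integers $n,k$ with $0\le k\le n/2$, $$a(n,k)=\sum_{j=0}^{k}(k-j+1)\binom{n-k-1}{j}.$$
   Context: $\Bbbk$ is a field of characteristic $0$; $\mathcal{M}$ is the free monoid on letters $D,U$; $\mathcal{W}=\Bbbk\langle D,U\mid DU-UD=1\rangle$; $\phi:\mathcal{M}\to\mathcal{W}$ is the monoid morphism with $D\mapsto D,U\mapsto U$. Words $u,v$ are Weyl-equivalent if $\phi(u)=\phi(v)$. For $0\le k\le n$, $a(n,k)$ is the number of Weyl-equivalence classes of words with $k$ letters $D$ and $n-k$ letters $U$. -}

module Defs where

open import Level using (Level; _⊔_)
open import Algebra.Bundles using (CommutativeRing)
open import Data.Nat using (ℕ; zero; suc; _≡ᵇ_)
open import Data.List using (List; []; _∷_; _++_; length; concatMap)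
open import Data.List.Relation.Unary.All using (All)
open import Data.List.Relation.Unary.Any using (Any)
open import Data.List.Relation.Unary.AllPairs using (AllPairs)
open import Data.Product using (Σ; ∃; _×_; _,_)
open import Relation.Nullary using (¬_; yes; no)
open import Relation.Binary.PropositionalEquality using (_≡_; refl)
import Data.List.Properties as LP

data Letter : Set where
  D U : Letter

_≟L_ : (x y : Letter) → Relation.Nullary.Dec (x ≡ y)
D ≟L D = yes refl
D ≟L U = no λ ()
U ≟L D = no λ ()
U ≟L U = yes refl

Word : Set
Word = List Letter

_≟W_ : (u v : Word) → Relation.Nullary.Dec (u ≡ v)
_≟W_ = LP.≡-dec _≟L_

countD : Word → ℕ
countD []      = 0
countD (D ∷ w) = suc (countD w)
countD (U ∷ w) = countD w

HasType : ℕ → ℕ → Word → Set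
HasType n k w = (length w ≡ n) × (countD w ≡ k)

module _ {c ℓ : Level} (R : CommutativeRing c ℓ) where
  open CommutativeRing R

  _•_ : ℕ → Carrier → Carrier
  zero  • x = 0#
  suc n • x = x + (n • x)

  IsField : Set (c ⊔ ℓ)
  IsField = (¬ (1# ≈ 0#)) × (∀ x → ¬ (x ≈ 0#) → ∃ λ y → (x * y) ≈ 1#)

  CharZero : Set ℓ
  CharZero = ∀ n → (n • 1#) ≈ 0# → n ≡ 0

  -- Elements of the free algebra k⟨D,U⟩ as formal finite linear combinations of words
  FreeElt : Set c
  FreeElt = List (Carrier × Word)

  coeff : Word → FreeElt → Carrier
  coeff w []             = 0#
  coeff w ((a , v) ∷ p) with w ≟W v
  ... | yes _ = a + coeff w p
  ... | no  _ = coeff w p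

  -- c · a (DU - UD - 1) b, expanded in the free algebra
  generator : Carrier × Word × Word → FreeElt
  generator (x , a , b) =
    (x , a ++ (D ∷ U ∷ b)) ∷ (- x , a ++ (U ∷ D ∷ b)) ∷ (- x , a ++ b) ∷ []

  -- p lies in the two-sided ideal generated by DU - UD - 1
  -- (every element of the ideal is a finite sum of terms c·a(DU-UD-1)b, a,b words)
  InIdeal : FreeElt → Set (c ⊔ ℓ)
  InIdeal p = Σ (List (Carrier × Word × Word)) λ gs →
    ∀ w → coeff w p ≈ coeff w (concatMap generator gs)

  -- Weyl-equivalence: φ(u) = φ(v) in W = k⟨D,U⟩/(DU - UD - 1)
  WeylEq : Word → Word → Set (c ⊔ ℓ)
  WeylEq u v = InIdeal ((1# , u) ∷ (- 1# , v) ∷ [])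

  ClassCount : ℕ → ℕ → ℕ → Set (c ⊔ ℓ)
  ClassCount n k m = Σ (List Word) λ reps →
    (length reps ≡ m) × All (HasType n k) reps ×
    AllPairs (λ u v → ¬ WeylEq u v) reps ×
    (∀ w → HasType n k w → Any (WeylEq w) reps)

module Submission where

-- Give each letter D of a word the height (number of D up to and including it) + (number of U after it).
-- Weyl-equivalent words have the same multiset of heights: in the representation D = d/dt, U = t a word
-- maps tᵉ to a multiple of a monomial, and for e = N + 1 + #D the multiplier is ∏ (N + 1 + g) over the
-- heights g, which in characteristic 0 determines the multiset once it is known for every N. Conversely,
-- if #D ≤ #U the relation DU = UD + 1 turns a word into U^(#U - #D) ∏ (θ + g - #D) with θ = UD, and these
-- factors commute, so words with equal height multisets are equivalent. The words D^a c D^b in which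
-- every D of c has a U on both sides realise each attainable multiset exactly once; with j letters D in c
-- there are k - j + 1 choices of (a, b) and C(n - k - 1, j) choices of c.

open import Defs
open import Level using (Level; _⊔_)
open import Algebra.Bundles using (CommutativeRing)
open import Data.Nat using (ℕ; zero; suc; _∸_; _≤_; _<_; z≤n; s≤s; _≟_; NonZero; ≢-nonZero)
import Data.Nat as Nat
import Data.Nat.Properties as ℕₚ
open import Data.Nat.Divisibility using (_∣_; ∣-trans; ∣m+n∣m⇒∣n; ∣1⇒≡1; ∣m⇒∣m*n)
open import Data.Nat.Coprimality using (Coprime; coprime-divisor)
open import Data.Nat.ListAction using (sum; product)
open import Data.Nat.ListAction.Properties using (sum-++; ∈⇒∣product; product-↭; product≢0)
open import Data.List
  using (List; []; _∷_; _++_; _∷ʳ_; [_]; map; foldr; concatMap; length; replicate; upTo; deduplicate)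
import Data.List.Properties as Listₚ
open import Data.List.Membership.Propositional using (_∈_; _∉_)
import Data.List.Membership.Propositional.Properties as ∈ₚ
open import Data.List.Membership.DecPropositional _≟_ using (_∈?_)
open import Data.List.Relation.Unary.Any as Any using (Any; here; there)
import Data.List.Relation.Unary.Any.Properties as Anyₚ
open import Data.List.Relation.Unary.All as All using (All; []; _∷_)
import Data.List.Relation.Unary.All.Properties as Allₚ
open import Data.List.Relation.Unary.AllPairs using (AllPairs; []; _∷_)
import Data.List.Relation.Unary.AllPairs.Properties as AllPairsₚ
open import Data.List.Relation.Unary.Unique.Propositional using (Unique)
import Data.List.Relation.Unary.Unique.DecPropositional.Properties as Uniqueₚ
open import Data.List.Relation.Binary.Permutation.Propositional
  using (_↭_; ↭-refl; ↭-sym; ↭-trans; prep; swap; ↭-reflexive; module PermutationReasoning)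
import Data.List.Relation.Binary.Permutation.Propositional as Perm
import Data.List.Relation.Binary.Permutation.Propositional.Properties as ↭ₚ
open import Data.Product as Product using (Σ; ∃; ∃₂; _×_; _,_; proj₁; proj₂; map₁; map₂)
open import Data.Sum using (_⊎_; inj₁; inj₂)
open import Data.Empty using (⊥; ⊥-elim)
open import Data.Maybe using (nothing)
open import Function using (_∘_)
open import Relation.Nullary using (¬_; yes; no)
open import Relation.Binary.Bundles using (Setoid)
open import Relation.Binary.Structures using (IsEquivalence)
import Relation.Binary.Reasoning.Setoid as SetoidReasoning
open import Relation.Binary.PropositionalEquality as ≡ using (_≡_; _≢_)
open import Tactic.RingSolver using (solve-∀)
open import Tactic.RingSolver.Core.AlmostCommutativeRing
  using (fromCommutativeRing; AlmostCommutativeRing)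

module ListProperties where
  open import Data.Nat using (_+_)
  open ≡ using (refl; sym; trans; cong; subst₂; module ≡-Reasoning)

  map-suc-+ : ∀ n gs → map suc (map (n +_) gs) ≡ map (n +_) (map suc gs)
  map-suc-+ n gs = begin
    map suc (map (n +_) gs)   ≡⟨ Listₚ.map-∘ gs ⟨
    map (λ g → suc (n + g)) gs ≡⟨ Listₚ.map-cong (λ g → ℕₚ.+-suc n g) gs ⟨
    map (λ g → n + suc g) gs  ≡⟨ Listₚ.map-∘ gs ⟩
    map (n +_) (map suc gs)   ∎
    where open ≡-Reasoning

  length-map-++ : ∀ {a b} {A : Set a} {B : Set b} (f : A → B) xs (ys : List B) →
    length (map f xs ++ ys) ≡ length xs + length ys
  length-map-++ f xs ys =
    trans (Listₚ.length-++ (map f xs)) (cong (_+ length ys) (Listₚ.length-map f xs))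

  allPairs-restrict : ∀ {a p r s} {A : Set a} {P : A → Set p}
                        {R : A → A → Set r} {S : A → A → Set s} {xs} →
    All P xs → (∀ {x y} → P x → P y → R x y → S x y) → AllPairs R xs → AllPairs S xs
  allPairs-restrict []         h []         = []
  allPairs-restrict (px ∷ pxs) h (rx ∷ rxs) =
    All.zipWith (λ (py , r) → h px py r) (pxs , rx) ∷ allPairs-restrict pxs h rxs

  map-suc-cancel : ∀ {xs ys} → map suc xs ↭ map suc ys → xs ↭ ys
  map-suc-cancel {xs} {ys} p = subst₂ _↭_ (pred∘suc xs) (pred∘suc ys) (↭ₚ.map⁺ Nat.pred p)
    where
    pred∘suc : ∀ zs → map Nat.pred (map suc zs) ≡ zs
    pred∘suc zs = trans (sym (Listₚ.map-∘ zs)) (Listₚ.map-id zs)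

  ∷ʳ-cancel : ∀ {xs ys : List ℕ} {a} → xs ∷ʳ a ↭ ys ∷ʳ a → xs ↭ ys
  ∷ʳ-cancel {xs} {ys} {a} p = ↭ₚ.drop-∷ (↭-trans (↭ₚ.∷↭∷ʳ a xs) (↭-trans p (↭-sym (↭ₚ.∷↭∷ʳ a ys))))

  ∉-if-all-< : ∀ {a xs} → All (_< a) xs → a ∉ xs
  ∉-if-all-< all a∈ = ℕₚ.<-irrefl refl (All.lookup all a∈)

  ∉-if-all-> : ∀ {a xs} → All (a <_) xs → a ∉ xs
  ∉-if-all-> all a∈ = ℕₚ.<-irrefl refl (All.lookup all a∈)

module FiniteSums where
  open import Data.Nat using (_+_; _*_)
  open ≡ using (refl; trans; cong; cong₂; module ≡-Reasoning)

  Σ≤ : ℕ → (ℕ → ℕ) → ℕ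
  Σ≤ k f = sum (map f (upTo (suc k)))

  Σ≤-suc : ∀ k f → Σ≤ (suc k) f ≡ Σ≤ k f + f (suc k)
  Σ≤-suc k f = begin
    sum (map f (upTo (suc (suc k))))
      ≡⟨ cong (sum ∘ map f) (Listₚ.applyUpTo-∷ʳ (λ j → j) (suc k)) ⟨
    sum (map f (upTo (suc k) ∷ʳ suc k))
      ≡⟨ cong sum (Listₚ.map-++ f (upTo (suc k)) [ suc k ]) ⟩
    sum (map f (upTo (suc k)) ++ [ f (suc k) ])
      ≡⟨ sum-++ (map f (upTo (suc k))) [ f (suc k) ] ⟩
    Σ≤ k f + (f (suc k) + 0)
      ≡⟨ cong (Σ≤ k f +_) (ℕₚ.+-identityʳ (f (suc k))) ⟩
    Σ≤ k f + f (suc k) ∎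
    where open ≡-Reasoning

  sum-map-+ : ∀ (f g : ℕ → ℕ) xs → sum (map (λ j → f j + g j) xs) ≡ sum (map f xs) + sum (map g xs)
  sum-map-+ f g []       = refl
  sum-map-+ f g (x ∷ xs) =
    trans (cong (f x + g x +_) (sum-map-+ f g xs))
          (+-CS.interchange (f x) (g x) (sum (map f xs)) (sum (map g xs)))
    where import Algebra.Properties.CommutativeSemigroup ℕₚ.+-commutativeSemigroup as +-CS

  Σ≤-weighted-suc : ∀ (c : ℕ → ℕ) k →
    Σ≤ (suc k) (λ j → (suc k ∸ j + 1) * c j) ≡ Σ≤ k (λ j → (k ∸ j + 1) * c j) + Σ≤ (suc k) c
  Σ≤-weighted-suc c k = begin
    Σ≤ (suc k) weight′
      ≡⟨ Σ≤-suc k weight′ ⟩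
    Σ≤ k weight′ + weight′ (suc k)
      ≡⟨ cong₂ _+_ (cong sum (Listₚ.map-cong-local (Allₚ.applyUpTo⁺₁ (λ j → j) (suc k) split)))
                   last ⟩
    Σ≤ k (λ j → weight j + c j) + c (suc k)
      ≡⟨ cong (_+ c (suc k)) (sum-map-+ weight c (upTo (suc k))) ⟩
    (Σ≤ k weight + Σ≤ k c) + c (suc k)
      ≡⟨ ℕₚ.+-assoc (Σ≤ k weight) (Σ≤ k c) (c (suc k)) ⟩
    Σ≤ k weight + (Σ≤ k c + c (suc k))
      ≡⟨ cong (Σ≤ k weight +_) (Σ≤-suc k c) ⟨
    Σ≤ k weight + Σ≤ (suc k) c ∎
    where
    open ≡-Reasoning
    weight weight′ : ℕ → ℕ
    weight  j = (k ∸ j + 1) * c j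
    weight′ j = (suc k ∸ j + 1) * c j
    split : ∀ {j} → j < suc k → weight′ j ≡ weight j + c j
    split {j} j<1+k = trans (cong (λ i → (i + 1) * c j) (ℕₚ.+-∸-assoc 1 (ℕₚ.≤-pred j<1+k)))
                            (ℕₚ.+-comm (c j) (weight j))
    last : weight′ (suc k) ≡ c (suc k)
    last = trans (cong (λ i → (i + 1) * c (suc k)) (ℕₚ.n∸n≡0 k)) (ℕₚ.+-identityʳ (c (suc k)))

module Words where
  open import Data.Nat using (_+_)
  open ≡ using (refl; sym; trans; cong; cong₂; module ≡-Reasoning)
  open ListProperties

  countU : Word → ℕ
  countU []      = 0
  countU (U ∷ w) = suc (countU w)
  countU (D ∷ w) = countU w

  countU-++ : ∀ u v → countU (u ++ v) ≡ countU u + countU v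
  countU-++ []      v = refl
  countU-++ (U ∷ u) v = cong suc (countU-++ u v)
  countU-++ (D ∷ u) v = countU-++ u v

  countD-++ : ∀ u v → countD (u ++ v) ≡ countD u + countD v
  countD-++ []      v = refl
  countD-++ (U ∷ u) v = countD-++ u v
  countD-++ (D ∷ u) v = cong suc (countD-++ u v)

  countU-insert : ∀ u x v → countU (u ++ x ++ v) ≡ countU x + countU (u ++ v)
  countU-insert []      x v = countU-++ x v
  countU-insert (U ∷ u) x v = trans (cong suc (countU-insert u x v)) (sym (ℕₚ.+-suc _ _))
  countU-insert (D ∷ u) x v = countU-insert u x v

  countD-insert : ∀ u x v → countD (u ++ x ++ v) ≡ countD x + countD (u ++ v)
  countD-insert []      x v = countD-++ x v
  countD-insert (U ∷ u) x v = countD-insert u x v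
  countD-insert (D ∷ u) x v = trans (cong suc (countD-insert u x v)) (sym (ℕₚ.+-suc _ _))

  length≡countU+countD : ∀ w → length w ≡ countU w + countD w
  length≡countU+countD []      = refl
  length≡countU+countD (U ∷ w) = cong suc (length≡countU+countD w)
  length≡countU+countD (D ∷ w) =
    trans (cong suc (length≡countU+countD w)) (sym (ℕₚ.+-suc (countU w) (countD w)))

  HasType⇒countU : ∀ {n k} w → length w ≡ n → countD w ≡ k → countU w ≡ n ∸ k
  HasType⇒countU {k = k} w len≡ d≡ = trans (sym (ℕₚ.m+n∸n≡m (countU w) (countD w)))
    (trans (cong₂ _∸_ (sym (length≡countU+countD w)) d≡) (cong (_∸ k) len≡))

  counts⇒HasType : ∀ {n k} w → k ≤ n → countU w ≡ n ∸ k × countD w ≡ k → HasType n k w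
  counts⇒HasType w k≤n (u≡ , d≡) =
    trans (length≡countU+countD w) (trans (cong₂ _+_ u≡ d≡) (ℕₚ.m∸n+n≡m k≤n)) , d≡

  U^_ D^_ : ℕ → Word
  U^ n = replicate n U
  D^ n = replicate n D

  heights : Word → List ℕ
  heights []      = []
  heights (U ∷ w) = heights w
  heights (D ∷ w) = suc (countU w) ∷ map suc (heights w)

  heights-++ : ∀ u v →
    heights (u ++ v) ≡ map (countU v +_) (heights u) ++ map (countD u +_) (heights v)
  heights-++ []      v = sym (Listₚ.map-id (heights v))
  heights-++ (U ∷ u) v = heights-++ u v
  heights-++ (D ∷ u) v = cong₂ _∷_ first rest
    where
    first : suc (countU (u ++ v)) ≡ countU v + suc (countU u)
    first = trans (cong suc (trans (countU-++ u v) (ℕₚ.+-comm (countU u) (countU v))))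
                  (sym (ℕₚ.+-suc (countU v) (countU u)))
    rest : map suc (heights (u ++ v))
         ≡ map (countU v +_) (map suc (heights u)) ++ map (suc (countD u) +_) (heights v)
    rest = begin
      map suc (heights (u ++ v))
        ≡⟨ cong (map suc) (heights-++ u v) ⟩
      map suc (map (countU v +_) (heights u) ++ map (countD u +_) (heights v))
        ≡⟨ Listₚ.map-++ suc (map (countU v +_) (heights u)) _ ⟩
      map suc (map (countU v +_) (heights u)) ++ map suc (map (countD u +_) (heights v))
        ≡⟨ cong₂ _++_ (map-suc-+ (countU v) (heights u)) (sym (Listₚ.map-∘ (heights v))) ⟩
      map (countU v +_) (map suc (heights u)) ++ map (suc (countD u) +_) (heights v) ∎
      where open ≡-Reasoning

  heights-∷ʳD : ∀ w → heights (w ∷ʳ D) ≡ heights w ∷ʳ suc (countD w)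
  heights-∷ʳD w =
    trans (heights-++ w [ D ])
          (cong₂ (λ hs g → hs ∷ʳ g) (Listₚ.map-id (heights w)) (ℕₚ.+-comm (countD w) 1))

  heights-DU : ∀ x y →
    heights (x ++ D ∷ U ∷ y) ↭ (2 + countD x + countU y) ∷ map suc (heights (x ++ y))
  heights-DU x y = begin
    heights (x ++ D ∷ U ∷ y)
      ≡⟨ heights-++ x (D ∷ U ∷ y) ⟩
    map (suc (countU y) +_) (heights x) ++
      (countD x + (2 + countU y)) ∷ map (countD x +_) (map suc (heights y))
      ≡⟨ cong₂ _++_ (Listₚ.map-∘ (heights x))
                    (cong₂ _∷_ (trans (ℕₚ.+-suc (countD x) _) (cong suc (ℕₚ.+-suc (countD x) _)))
                               (sym (map-suc-+ (countD x) (heights y)))) ⟩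
    xs ++ t ∷ ys
      ↭⟨ ↭ₚ.shift t xs ys ⟩
    t ∷ xs ++ ys
      ≡⟨ cong (t ∷_) (Listₚ.map-++ suc (map (countU y +_) (heights x)) _) ⟨
    t ∷ map suc (map (countU y +_) (heights x) ++ map (countD x +_) (heights y))
      ≡⟨ cong (λ hs → t ∷ map suc hs) (heights-++ x y) ⟨
    t ∷ map suc (heights (x ++ y)) ∎
    where
    open PermutationReasoning
    t = 2 + countD x + countU y
    xs = map suc (map (countU y +_) (heights x))
    ys = map suc (map (countD x +_) (heights y))

  first-height : ∀ w → 0 < countD w → Any (_≤ suc (countU w)) (heights w)
  first-height (U ∷ w) d>0 = Any.map ℕₚ.m≤n⇒m≤1+n (first-height w d>0)
  first-height (D ∷ w) _   = here ℕₚ.≤-refl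

  last-height : ∀ w → 0 < countD w → Any (countD w ≤_) (heights w)
  last-height (U ∷ w) d>0 = last-height w d>0
  last-height (D ∷ w) _ with 0 ℕₚ.<? countD w
  ... | yes d>0 = there (Anyₚ.map⁺ (Any.map s≤s (last-height w d>0)))
  ... | no d≯0  = here (s≤s (ℕₚ.≤-trans (ℕₚ.≮⇒≥ d≯0) z≤n))

module ShiftedProducts where
  open import Data.Nat using (_+_; _*_; ∣_-_∣)
  open ≡ using (refl; sym; trans; cong; subst; module ≡-Reasoning)

  shiftedProduct : ℕ → List ℕ → ℕ
  shiftedProduct N gs = product (map (suc N +_) gs)

  shiftedProduct-↭ : ∀ N {xs ys} → xs ↭ ys → shiftedProduct N xs ≡ shiftedProduct N ys
  shiftedProduct-↭ N p = product-↭ (↭ₚ.map⁺ (suc N +_) p)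

  shiftedProduct-map-suc : ∀ N gs → shiftedProduct N (map suc gs) ≡ shiftedProduct (suc N) gs
  shiftedProduct-map-suc N gs = cong product (begin
    map (suc N +_) (map suc gs) ≡⟨ sym (Listₚ.map-∘ gs) ⟩
    map (λ g → suc N + suc g) gs ≡⟨ Listₚ.map-cong (ℕₚ.+-suc (suc N)) gs ⟩
    map (suc (suc N) +_) gs ∎)
    where open ≡-Reasoning

  ∣m∣n⇒∣∣m-n∣ : ∀ {d m n} → d ∣ m → d ∣ n → d ∣ ∣ m - n ∣
  ∣m∣n⇒∣∣m-n∣ {d} {m} {n} d∣m d∣n with ℕₚ.≤-total m n
  ... | inj₁ m≤n = subst (d ∣_) (sym (ℕₚ.m≤n⇒∣m-n∣≡n∸m m≤n))
                         (∣m+n∣m⇒∣n (subst (d ∣_) (sym (ℕₚ.m+[n∸m]≡n m≤n)) d∣n) d∣m)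
  ... | inj₂ n≤m = subst (d ∣_) (sym (ℕₚ.m≤n⇒∣n-m∣≡n∸m n≤m))
                         (∣m+n∣m⇒∣n (subst (d ∣_) (sym (ℕₚ.m+[n∸m]≡n n≤m)) d∣m) d∣n)

  ∣distance⇒coprime : ∀ {q n} → ∣ suc q - n ∣ ∣ q → Coprime (suc q) n
  ∣distance⇒coprime {q} dist∣q {c} (c∣1+q , c∣n) =
    ∣1⇒≡1 (∣m+n∣m⇒∣n (subst (c ∣_) (ℕₚ.+-comm 1 q) c∣1+q)
                     (∣-trans (∣m∣n⇒∣∣m-n∣ c∣1+q c∣n) dist∣q))

  coprime-∣product⇒∣1 : ∀ {p} ns → All (Coprime p) ns → p ∣ product ns → p ∣ 1
  coprime-∣product⇒∣1 []       []           p∣1 = p∣1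
  coprime-∣product⇒∣1 (n ∷ ns) (cop ∷ cops) p∣ = coprime-∣product⇒∣1 ns cops (coprime-divisor cop p∣)

  -- With d = ∏_{y ∈ ys} |x - y| and p = 1 + d (x + 1), the shift N = p - 1 - x makes
  -- N + 1 + x = p coprime to every N + 1 + y, since |p - (N + 1 + y)| = |x - y| divides p - 1.
  separatingShift : ∀ {x ys} → x ∉ ys →
    ∃ λ N → 2 ≤ suc N + x × All (λ y → Coprime (suc N + x) (suc N + y)) ys
  separatingShift {x} {ys} x∉ys = N , 2≤p , All.tabulate coprime
    where
    d = product (map (∣ x -_∣) ys)
    instance
      d≢0 : NonZero d
      d≢0 = product≢0 (Allₚ.map⁺ (All.tabulate λ {y} y∈ys →
              ≢-nonZero λ ∣x-y∣≡0 → x∉ys (subst (_∈ ys) (sym (ℕₚ.∣m-n∣≡0⇒m≡n ∣x-y∣≡0)) y∈ys)))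
    1+x≤d[1+x] : suc x ≤ d * suc x
    1+x≤d[1+x] = ℕₚ.m≤n*m (suc x) d
    N = d * suc x ∸ x
    p≡ : suc N + x ≡ suc (d * suc x)
    p≡ = cong suc (ℕₚ.m∸n+n≡m (ℕₚ.≤-trans (ℕₚ.n≤1+n x) 1+x≤d[1+x]))
    2≤p : 2 ≤ suc N + x
    2≤p = subst (2 ≤_) (sym p≡) (s≤s (ℕₚ.≤-trans (s≤s z≤n) 1+x≤d[1+x]))
    distance : ∀ y → ∣ suc (d * suc x) - suc N + y ∣ ≡ ∣ x - y ∣
    distance y = trans (cong (λ p → ∣ p - suc N + y ∣) (sym p≡)) (ℕₚ.∣m+n-m+o∣≡∣n-o∣ (suc N) x y)
    coprime : ∀ {y} → y ∈ ys → Coprime (suc N + x) (suc N + y)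
    coprime {y} y∈ys = subst (λ p → Coprime p (suc N + y)) (sym p≡) (∣distance⇒coprime
      (subst (_∣ d * suc x) (sym (distance y))
             (∣m⇒∣m*n (suc x) (∈⇒∣product (∈ₚ.∈-map⁺ ∣ x -_∣ y∈ys)))))

  shiftedProducts-separate : ∀ {x} {xs ys : List ℕ} → x ∈ xs → x ∉ ys →
    ∃ λ N → shiftedProduct N xs ≢ shiftedProduct N ys
  shiftedProducts-separate {x} {xs} {ys} x∈xs x∉ys with separatingShift x∉ys
  ... | N , 2≤p , coprimes = N , λ eq → ℕₚ.<-irrefl refl (subst (2 ≤_) (p≡1 eq) 2≤p)
    where
    p∣xs : suc N + x ∣ shiftedProduct N xs
    p∣xs = ∈⇒∣product (∈ₚ.∈-map⁺ (suc N +_) x∈xs)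
    p≡1 : shiftedProduct N xs ≡ shiftedProduct N ys → suc N + x ≡ 1
    p≡1 eq = ∣1⇒≡1 (coprime-∣product⇒∣1 (map (suc N +_) ys) (Allₚ.map⁺ coprimes)
                                        (subst (suc N + x ∣_) eq p∣xs))

  shiftedProduct-injective : ∀ xs ys → (∀ N → shiftedProduct N xs ≡ shiftedProduct N ys) → xs ↭ ys
  shiftedProduct-injective []       []       _  = ↭-refl
  shiftedProduct-injective []       (y ∷ ys) eq
    with shiftedProducts-separate {xs = y ∷ ys} {ys = []} (here refl) (λ ())
  ... | N , differ = ⊥-elim (differ (sym (eq N)))
  shiftedProduct-injective (x ∷ xs) ys       eq with x ∈? ys
  ... | no x∉ys with shiftedProducts-separate {xs = x ∷ xs} (here refl) x∉ys
  ...   | N , differ = ⊥-elim (differ (eq N))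
  shiftedProduct-injective (x ∷ xs) ys eq | yes x∈ys with ∈ₚ.∈-∃++ x∈ys
  ... | ys₁ , ys₂ , refl =
    ↭-trans (prep x (shiftedProduct-injective xs (ys₁ ++ ys₂) cancelled)) (↭-sym (↭ₚ.shift x ys₁ ys₂))
    where
    cancelled : ∀ N → shiftedProduct N xs ≡ shiftedProduct N (ys₁ ++ ys₂)
    cancelled N = ℕₚ.*-cancelˡ-≡ _ _ (suc N + x)
      (trans (eq N) (shiftedProduct-↭ N (↭ₚ.shift x ys₁ ys₂)))

module CanonicalWords where
  open import Data.Nat using (_+_; _*_)
  open import Data.Nat.Combinatorics using (_C_; nCk+nC[k+1]≡[n+1]C[k+1])
  open ≡ using (refl; sym; trans; cong; cong₂; module ≡-Reasoning)
  open ListProperties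
  open FiniteSums
  open Words

  -- Core m j w: w has m letters U and j letters D, and every D has a U on both sides.
  data Core : ℕ → ℕ → Word → Set where
    []   : Core 0 0 []
    U∷_  : ∀ {m j w} → Core m j w → Core (suc m) j (U ∷ w)
    UD∷_ : ∀ {m j w} → Core (suc m) j w → Core (suc (suc m)) (suc j) (U ∷ D ∷ w)

  data Tail : ℕ → ℕ → Word → Set where
    core : ∀ {m j w} → Core m j w → Tail m j w
    _∷ʳD : ∀ {m k w} → Tail m k w → Tail m (suc k) (w ∷ʳ D)

  -- The words D^a c D^b with c a core, where a + (number of D in c) + b = k.
  data Canonical : ℕ → ℕ → Word → Set where
    tail : ∀ {m k w} → Tail m k w → Canonical m k w
    D∷_  : ∀ {m k w} → Canonical m k w → Canonical m (suc k) (D ∷ w)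

  cores : ℕ → ℕ → List Word
  cores zero          zero    = [ [] ]
  cores zero          (suc j) = []
  cores (suc m)       zero    = map (U ∷_) (cores m zero)
  cores (suc zero)    (suc j) = []
  cores (suc (suc m)) (suc j) =
    map (U ∷_) (cores (suc m) (suc j)) ++ map (λ w → U ∷ D ∷ w) (cores (suc m) j)

  tails : ℕ → ℕ → List Word
  tails m zero    = cores m zero
  tails m (suc k) = map (_∷ʳ D) (tails m k) ++ cores m (suc k)

  canonicals : ℕ → ℕ → List Word
  canonicals m zero    = tails m zero
  canonicals m (suc k) = map (D ∷_) (canonicals m k) ++ tails m (suc k)

  ∈-cores⁺ : ∀ {m j w} → Core m j w → w ∈ cores m j
  ∈-cores⁺ []                                 = here refl
  ∈-cores⁺ (U∷_ {j = zero} c)                 = ∈ₚ.∈-map⁺ (U ∷_) (∈-cores⁺ c)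
  ∈-cores⁺ (U∷_ {m = suc m} {j = suc j} c)    = ∈ₚ.∈-++⁺ˡ (∈ₚ.∈-map⁺ (U ∷_) (∈-cores⁺ c))
  ∈-cores⁺ (UD∷_ {m = m} {j = j} c)           =
    ∈ₚ.∈-++⁺ʳ (map (U ∷_) (cores (suc m) (suc j))) (∈ₚ.∈-map⁺ (λ w → U ∷ D ∷ w) (∈-cores⁺ c))

  ∈-tails⁺ : ∀ {m k w} → Tail m k w → w ∈ tails m k
  ∈-tails⁺ (core {j = zero} c)          = ∈-cores⁺ c
  ∈-tails⁺ (core {m = m} {j = suc j} c) = ∈ₚ.∈-++⁺ʳ (map (_∷ʳ D) (tails m j)) (∈-cores⁺ c)
  ∈-tails⁺ (τ ∷ʳD)                      = ∈ₚ.∈-++⁺ˡ (∈ₚ.∈-map⁺ (_∷ʳ D) (∈-tails⁺ τ))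

  ∈-canonicals⁺ : ∀ {m k w} → Canonical m k w → w ∈ canonicals m k
  ∈-canonicals⁺ (tail {k = zero} τ)          = ∈-tails⁺ τ
  ∈-canonicals⁺ (tail {m = m} {k = suc k} τ) = ∈ₚ.∈-++⁺ʳ (map (D ∷_) (canonicals m k)) (∈-tails⁺ τ)
  ∈-canonicals⁺ (D∷ c)                       = ∈ₚ.∈-++⁺ˡ (∈ₚ.∈-map⁺ (D ∷_) (∈-canonicals⁺ c))

  ∈-cores⁻ : ∀ m j {w} → w ∈ cores m j → Core m j w
  ∈-cores⁻ zero zero (here refl) = []
  ∈-cores⁻ (suc m) zero w∈ with ∈ₚ.∈-map⁻ (U ∷_) w∈
  ... | v , v∈ , refl = U∷ ∈-cores⁻ m zero v∈
  ∈-cores⁻ (suc (suc m)) (suc j) w∈ with ∈ₚ.∈-++⁻ (map (U ∷_) (cores (suc m) (suc j))) w∈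
  ... | inj₁ w∈₁ with ∈ₚ.∈-map⁻ (U ∷_) w∈₁
  ...   | v , v∈ , refl = U∷ ∈-cores⁻ (suc m) (suc j) v∈
  ∈-cores⁻ (suc (suc m)) (suc j) w∈ | inj₂ w∈₂ with ∈ₚ.∈-map⁻ (λ w → U ∷ D ∷ w) w∈₂
  ...   | v , v∈ , refl = UD∷ ∈-cores⁻ (suc m) j v∈

  ∈-tails⁻ : ∀ m k {w} → w ∈ tails m k → Tail m k w
  ∈-tails⁻ m zero w∈ = core (∈-cores⁻ m zero w∈)
  ∈-tails⁻ m (suc k) w∈ with ∈ₚ.∈-++⁻ (map (_∷ʳ D) (tails m k)) w∈
  ... | inj₂ w∈₂ = core (∈-cores⁻ m (suc k) w∈₂)
  ... | inj₁ w∈₁ with ∈ₚ.∈-map⁻ (_∷ʳ D) w∈₁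
  ...   | v , v∈ , refl = ∈-tails⁻ m k v∈ ∷ʳD

  ∈-canonicals⁻ : ∀ m k {w} → w ∈ canonicals m k → Canonical m k w
  ∈-canonicals⁻ m zero w∈ = tail (∈-tails⁻ m zero w∈)
  ∈-canonicals⁻ m (suc k) w∈ with ∈ₚ.∈-++⁻ (map (D ∷_) (canonicals m k)) w∈
  ... | inj₂ w∈₂ = tail (∈-tails⁻ m (suc k) w∈₂)
  ... | inj₁ w∈₁ with ∈ₚ.∈-map⁻ (D ∷_) w∈₁
  ...   | v , v∈ , refl = D∷ ∈-canonicals⁻ m k v∈

  core-counts : ∀ {m j w} → Core m j w → countU w ≡ m × countD w ≡ j
  core-counts []      = refl , refl
  core-counts (U∷ c)  = map₁ (cong suc) (core-counts c)
  core-counts (UD∷ c) = Product.map (cong suc) (cong suc) (core-counts c)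

  tail-counts : ∀ {m k w} → Tail m k w → countU w ≡ m × countD w ≡ k
  tail-counts (core c) = core-counts c
  tail-counts (_∷ʳD {w = w} τ) with tail-counts τ
  ... | u≡ , d≡ = trans (countU-++ w [ D ]) (trans (ℕₚ.+-identityʳ _) u≡)
                , trans (countD-++ w [ D ]) (trans (ℕₚ.+-comm _ 1) (cong suc d≡))

  canonical-counts : ∀ {m k w} → Canonical m k w → countU w ≡ m × countD w ≡ k
  canonical-counts (tail τ) = tail-counts τ
  canonical-counts (D∷ c)   = map₂ (cong suc) (canonical-counts c)

  cores-counts : ∀ m j → All (λ w → countU w ≡ m × countD w ≡ j) (cores m j)
  cores-counts m j = All.tabulate (core-counts ∘ ∈-cores⁻ m j)

  tails-counts : ∀ m k → All (λ w → countU w ≡ m × countD w ≡ k) (tails m k)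
  tails-counts m k = All.tabulate (tail-counts ∘ ∈-tails⁻ m k)

  canonicals-counts : ∀ m k → All (λ w → countU w ≡ m × countD w ≡ k) (canonicals m k)
  canonicals-counts m k = All.tabulate (canonical-counts ∘ ∈-canonicals⁻ m k)

  length-cores : ∀ m j → length (cores m j) ≡ (m ∸ 1) C j
  length-cores zero          zero    = refl
  length-cores zero          (suc j) = refl
  length-cores (suc m)       zero    =
    trans (Listₚ.length-map (U ∷_) (cores m zero)) (length-cores m zero)
  length-cores (suc zero)    (suc j) = refl
  length-cores (suc (suc m)) (suc j) = begin
    length (map (U ∷_) (cores (suc m) (suc j)) ++ map (λ w → U ∷ D ∷ w) (cores (suc m) j))
      ≡⟨ length-map-++ (U ∷_) (cores (suc m) (suc j)) _ ⟩
    length (cores (suc m) (suc j)) + length (map (λ w → U ∷ D ∷ w) (cores (suc m) j))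
      ≡⟨ cong₂ _+_ (length-cores (suc m) (suc j))
                   (trans (Listₚ.length-map _ (cores (suc m) j)) (length-cores (suc m) j)) ⟩
    m C suc j + m C j
      ≡⟨ ℕₚ.+-comm (m C suc j) (m C j) ⟩
    m C j + m C suc j
      ≡⟨ nCk+nC[k+1]≡[n+1]C[k+1] m j ⟩
    suc m C suc j ∎
    where open ≡-Reasoning

  length-tails : ∀ m k → length (tails m k) ≡ Σ≤ k ((m ∸ 1) C_)
  length-tails m zero    = trans (length-cores m zero) (sym (ℕₚ.+-identityʳ _))
  length-tails m (suc k) = begin
    length (map (_∷ʳ D) (tails m k) ++ cores m (suc k))
      ≡⟨ length-map-++ (_∷ʳ D) (tails m k) (cores m (suc k)) ⟩
    length (tails m k) + length (cores m (suc k))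
      ≡⟨ cong₂ _+_ (length-tails m k) (length-cores m (suc k)) ⟩
    Σ≤ k ((m ∸ 1) C_) + (m ∸ 1) C suc k
      ≡⟨ Σ≤-suc k ((m ∸ 1) C_) ⟨
    Σ≤ (suc k) ((m ∸ 1) C_) ∎
    where open ≡-Reasoning

  length-canonicals : ∀ m k → length (canonicals m k) ≡ Σ≤ k (λ j → (k ∸ j + 1) * ((m ∸ 1) C j))
  length-canonicals m zero    = trans (length-tails m zero) (cong (_+ 0) (sym (ℕₚ.+-identityʳ _)))
  length-canonicals m (suc k) = begin
    length (map (D ∷_) (canonicals m k) ++ tails m (suc k))
      ≡⟨ length-map-++ (D ∷_) (canonicals m k) (tails m (suc k)) ⟩
    length (canonicals m k) + length (tails m (suc k))
      ≡⟨ cong₂ _+_ (length-canonicals m k) (length-tails m (suc k)) ⟩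
    Σ≤ k (λ j → (k ∸ j + 1) * ((m ∸ 1) C j)) + Σ≤ (suc k) ((m ∸ 1) C_)
      ≡⟨ Σ≤-weighted-suc ((m ∸ 1) C_) k ⟨
    Σ≤ (suc k) (λ j → (suc k ∸ j + 1) * ((m ∸ 1) C j)) ∎
    where open ≡-Reasoning

module CanonicalHeights where
  open import Data.Nat using (_+_)
  open ≡ using (sym; trans; cong; subst; subst₂)
  open ListProperties
  open Words
  open CanonicalWords

  core-D≤U : ∀ {m j w} → Core (suc m) j w → j ≤ m
  core-D≤U (U∷ [])          = z≤n
  core-D≤U (U∷ c@(U∷ _))    = ℕₚ.m≤n⇒m≤1+n (core-D≤U c)
  core-D≤U (U∷ c@(UD∷ _))   = ℕₚ.m≤n⇒m≤1+n (core-D≤U c)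
  core-D≤U (UD∷ c)          = s≤s (core-D≤U c)

  core-heights : ∀ {m j w} → Core m j w → All (λ g → j < g × g ≤ m) (heights w)
  core-heights []      = []
  core-heights (U∷ c)  = All.map (map₂ ℕₚ.m≤n⇒m≤1+n) (core-heights c)
  core-heights (UD∷ c) rewrite proj₁ (core-counts c) =
    (s≤s (s≤s (core-D≤U c)) , ℕₚ.≤-refl) ∷ Allₚ.map⁺ (All.map (Product.map s≤s s≤s) (core-heights c))

  coreDs : ∀ {m k w} → Tail m k w → ℕ
  coreDs (core {j = j} _) = j
  coreDs (τ ∷ʳD)          = coreDs τ

  coreDs≤ : ∀ {m k w} (τ : Tail m k w) → coreDs τ ≤ k
  coreDs≤ (core _) = ℕₚ.≤-refl
  coreDs≤ (τ ∷ʳD)  = ℕₚ.m≤n⇒m≤1+n (coreDs≤ τ)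

  tail-heights : ∀ {m k w} (τ : Tail m k w) → k ≤ m → All (λ g → coreDs τ < g × g ≤ m) (heights w)
  tail-heights (core c) _ = core-heights c
  tail-heights (_∷ʳD {w = w} τ) k<m rewrite heights-∷ʳD w | proj₂ (tail-counts τ) =
    Allₚ.∷ʳ⁺ (tail-heights τ (ℕₚ.<⇒≤ k<m)) (s≤s (coreDs≤ τ) , k<m)

  leadingDs innerDs : ∀ {m k w} → Canonical m k w → ℕ
  leadingDs (tail _) = 0
  leadingDs (D∷ c)   = suc (leadingDs c)
  innerDs (tail τ) = coreDs τ
  innerDs (D∷ c)   = suc (innerDs c)

  innerDs≤ : ∀ {m k w} (c : Canonical m k w) → innerDs c ≤ k
  innerDs≤ (tail τ) = coreDs≤ τ
  innerDs≤ (D∷ c)   = s≤s (innerDs≤ c)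

  canonical-heights : ∀ {m k w} (c : Canonical m k w) → k ≤ m →
    All (λ g → innerDs c < g × g ≤ leadingDs c + m) (heights w)
  canonical-heights (tail τ) k≤m = tail-heights τ k≤m
  canonical-heights {m} (D∷ c) k<m rewrite proj₁ (canonical-counts c) =
    (s≤s (ℕₚ.≤-trans (s≤s (innerDs≤ c)) k<m) , s≤s (ℕₚ.m≤n+m m (leadingDs c)))
    ∷ Allₚ.map⁺ (All.map (Product.map s≤s s≤s) (canonical-heights c (ℕₚ.<⇒≤ k<m)))

  HeightsDiffer : Word → Word → Set
  HeightsDiffer u v = ¬ (heights u ↭ heights v)

  apartˡ : ∀ {a u v} → a ∈ heights u → a ∉ heights v → HeightsDiffer u v
  apartˡ a∈u a∉v p = a∉v (↭ₚ.∈-resp-↭ p a∈u)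

  apartʳ : ∀ {a u v} → a ∉ heights u → a ∈ heights v → HeightsDiffer u v
  apartʳ a∉u a∈v p = a∉u (↭ₚ.∈-resp-↭ (↭-sym p) a∈v)

  heights-D∷-cancel : ∀ {u v} → countU u ≡ countU v →
    heights (D ∷ u) ↭ heights (D ∷ v) → heights u ↭ heights v
  heights-D∷-cancel {u} {v} u≡v p =
    map-suc-cancel (↭ₚ.drop-∷ (subst (λ n → suc n ∷ map suc (heights u) ↭ heights (D ∷ v)) u≡v p))

  heights-∷ʳD-cancel : ∀ {u v} → countD u ≡ countD v →
    heights (u ∷ʳ D) ↭ heights (v ∷ʳ D) → heights u ↭ heights v
  heights-∷ʳD-cancel {u} {v} u≡v p =
    ∷ʳ-cancel (subst₂ _↭_ (trans (heights-∷ʳD u) (cong (λ n → heights u ∷ʳ suc n) u≡v))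
                          (heights-∷ʳD v) p)

  cores-distinct : ∀ m j → AllPairs HeightsDiffer (cores m j)
  cores-distinct zero          zero    = [] ∷ []
  cores-distinct zero          (suc j) = []
  cores-distinct (suc m)       zero    = AllPairsₚ.map⁺ (cores-distinct m zero)
  cores-distinct (suc zero)    (suc j) = []
  cores-distinct (suc (suc m)) (suc j) = AllPairsₚ.++⁺
    (AllPairsₚ.map⁺ (cores-distinct (suc m) (suc j)))
    (AllPairsₚ.map⁺ (allPairs-restrict (cores-counts (suc m) j)
      (λ {u} {v} (u≡ , _) (v≡ , _) differ → differ ∘ heights-D∷-cancel {u} {v} (trans u≡ (sym v≡)))
      (cores-distinct (suc m) j)))
    (Allₚ.map⁺ (All.tabulate λ {u} u∈ → Allₚ.map⁺ (All.tabulate λ {v} v∈ →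
      apartʳ {u = U ∷ u} {U ∷ D ∷ v}
             (∉-if-all-< (All.map (s≤s ∘ proj₂) (core-heights (∈-cores⁻ (suc m) (suc j) u∈))))
             (here (cong suc (sym (proj₁ (core-counts (∈-cores⁻ (suc m) j v∈)))))))))

  tails-distinct : ∀ m k → AllPairs HeightsDiffer (tails m k)
  tails-distinct m zero    = cores-distinct m zero
  tails-distinct m (suc k) = AllPairsₚ.++⁺
    (AllPairsₚ.map⁺ (allPairs-restrict (tails-counts m k)
      (λ {u} {v} (_ , u≡) (_ , v≡) differ → differ ∘ heights-∷ʳD-cancel {u} {v} (trans u≡ (sym v≡)))
      (tails-distinct m k)))
    (cores-distinct m (suc k))
    (Allₚ.map⁺ (All.tabulate λ {u} u∈ → All.tabulate λ {v} v∈ →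
      apartˡ {u = u ∷ʳ D} {v} (subst (suc k ∈_) (sym (heights-∷ʳD u))
                    (∈ₚ.∈-++⁺ʳ (heights u)
                       (here (cong suc (sym (proj₂ (tail-counts (∈-tails⁻ m k u∈))))))))
             (∉-if-all-> (All.map proj₁ (core-heights (∈-cores⁻ m (suc k) v∈))))))

  canonicals-distinct : ∀ m k → k ≤ m → AllPairs HeightsDiffer (canonicals m k)
  canonicals-distinct m zero    _   = tails-distinct m zero
  canonicals-distinct m (suc k) k<m = AllPairsₚ.++⁺
    (AllPairsₚ.map⁺ (allPairs-restrict (canonicals-counts m k)
      (λ {u} {v} (u≡ , _) (v≡ , _) differ → differ ∘ heights-D∷-cancel {u} {v} (trans u≡ (sym v≡)))
      (canonicals-distinct m k (ℕₚ.<⇒≤ k<m))))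
    (tails-distinct m (suc k))
    (Allₚ.map⁺ (All.tabulate λ {u} u∈ → All.tabulate λ {v} v∈ →
      apartˡ {u = D ∷ u} {v} (here (cong suc (sym (proj₁ (canonical-counts (∈-canonicals⁻ m k u∈))))))
             (∉-if-all-< (All.map (s≤s ∘ proj₂) (tail-heights (∈-tails⁻ m (suc k) v∈) k<m)))))

module Canonicalisation where
  open import Data.Nat using (_+_)
  open ≡ using (refl; sym; trans; cong; subst; subst₂)
  open Words
  open CanonicalWords
  open CanonicalHeights

  U∷ᵗ_ : ∀ {m k w} → Tail m k w → Tail (suc m) k (U ∷ w)
  U∷ᵗ (core c) = core (U∷ c)
  U∷ᵗ (τ ∷ʳD)  = (U∷ᵗ τ) ∷ʳD

  heights-D∷-insert : ∀ {u v t} → countU v ≡ suc (countU u) → heights v ↭ t ∷ map suc (heights u) →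
    heights (D ∷ v) ↭ suc t ∷ map suc (heights (D ∷ u))
  heights-D∷-insert {u} {v} {t} v≡ p = begin
    suc (countU v) ∷ map suc (heights v)
      ≡⟨ cong (λ n → suc n ∷ map suc (heights v)) v≡ ⟩
    suc (suc (countU u)) ∷ map suc (heights v)
      ↭⟨ prep _ (↭ₚ.map⁺ suc p) ⟩
    suc (suc (countU u)) ∷ suc t ∷ map suc (map suc (heights u))
      ↭⟨ swap _ _ ↭-refl ⟩
    suc t ∷ suc (suc (countU u)) ∷ map suc (map suc (heights u)) ∎
    where open PermutationReasoning

  Insertion : (Word → Set) → ℕ → Word → Set
  Insertion P t v = ∃ λ r → P r × heights r ↭ t ∷ map suc (heights v)

  insertTop : ∀ {m j v} → Core m j v → 2 + j ≤ suc m → Insertion (Core (suc m) (suc j)) (suc m) v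
  insertTop {zero}          _ (s≤s ())
  insertTop {suc m} {v = v} c _ =
    U ∷ D ∷ v , UD∷ c , ↭-reflexive (cong (λ n → suc n ∷ map suc (heights v)) (proj₁ (core-counts c)))

  mutual
    insertCore : ∀ {m j v} → Core m j v → ∀ t → 2 + j ≤ t → t ≤ suc m →
      Insertion (Core (suc m) (suc j)) t v
    insertCore {m} c t lo hi with t ≟ suc m
    ... | yes refl   = insertTop c lo
    ... | no t≢1+m = insertBelow c t lo (ℕₚ.≤-pred (ℕₚ.≤∧≢⇒< hi t≢1+m))

    insertBelow : ∀ {m j v} → Core m j v → ∀ t → 2 + j ≤ t → t ≤ m →
      Insertion (Core (suc m) (suc j)) t v
    insertBelow [] _ () z≤n
    insertBelow (U∷ c) t lo hi with insertCore c t lo hi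
    ... | r , c′ , p = U ∷ r , U∷ c′ , p
    insertBelow (UD∷ c) zero () _
    insertBelow (UD∷_ {w = v} c) (suc t) (s≤s lo) hi with insertCore c t lo (ℕₚ.m≤n⇒m≤1+n (ℕₚ.≤-pred hi))
    ... | r , c′ , p = U ∷ D ∷ r , UD∷ c′ ,
      heights-D∷-insert {v} {r}
        (trans (proj₁ (core-counts c′)) (cong suc (sym (proj₁ (core-counts c))))) p

  insertTail : ∀ {m k w} (τ : Tail m k w) → ∀ t → 2 + coreDs τ ≤ t → t ≤ suc m →
    Insertion (Tail (suc m) (suc k)) t w
  insertTail (core c) t lo hi with insertCore c t lo hi
  ... | r , c′ , p = r , core c′ , p
  insertTail (_∷ʳD {k = k} {w = w} τ) t lo hi with insertTail τ t lo hi
  ... | r , τ′ , p = r ∷ʳ D , τ′ ∷ʳD , (begin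
    heights (r ∷ʳ D)                     ≡⟨ heights-∷ʳD r ⟩
    heights r ∷ʳ suc (countD r)          ≡⟨ cong (λ n → heights r ∷ʳ suc n) (proj₂ (tail-counts τ′)) ⟩
    heights r ∷ʳ suc (suc k)             ↭⟨ ↭ₚ.++⁺ʳ [ suc (suc k) ] p ⟩
    t ∷ map suc (heights w) ∷ʳ suc (suc k) ≡⟨ cong (t ∷_) (Listₚ.map-++ suc (heights w) [ suc k ]) ⟨
    t ∷ map suc (heights w ∷ʳ suc k)     ≡⟨ cong (λ hs → t ∷ map suc hs) (trans
                                             (cong (λ n → heights w ∷ʳ suc n) (sym (proj₂ (tail-counts τ))))
                                             (sym (heights-∷ʳD w))) ⟩
    t ∷ map suc (heights (w ∷ʳ D))       ∎)
    where open PermutationReasoning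

  insertCanonical : ∀ {m k w} (c : Canonical m k w) → ∀ t → 2 + innerDs c ≤ t → t ≤ 2 + leadingDs c + m →
    Insertion (Canonical (suc m) (suc k)) t w
  insertCanonical {m} {w = w} (tail τ) t lo hi with t ≟ 2 + m
  ... | yes refl = D ∷ U ∷ w , D∷ tail (U∷ᵗ τ) ,
    ↭-reflexive (cong (λ n → suc (suc n) ∷ map suc (heights w)) (proj₁ (tail-counts τ)))
  ... | no t≢2+m with insertTail τ t lo (ℕₚ.≤-pred (ℕₚ.≤∧≢⇒< hi t≢2+m))
  ...   | r , τ′ , p = r , tail τ′ , p
  insertCanonical (D∷ c) zero () _
  insertCanonical (D∷_ {w = w} c) (suc t) (s≤s lo) (s≤s hi) with insertCanonical c t lo hi
  ... | r , c′ , p = D ∷ r , D∷ c′ ,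
    heights-D∷-insert {w} {r}
      (trans (proj₁ (canonical-counts c′)) (cong suc (sym (proj₁ (canonical-counts c))))) p

  module _ x y {r} (c : Canonical (countU (x ++ y)) (countD (x ++ y)) r)
           (r↭xy : heights r ↭ heights (x ++ y)) (d≤u : countD (x ++ y) ≤ countU (x ++ y)) where

    private
      bounds : All (λ g → innerDs c < g × g ≤ leadingDs c + countU (x ++ y)) (heights (x ++ y))
      bounds = ↭ₚ.All-resp-↭ r↭xy (canonical-heights c d≤u)

    insertion-lo : 2 + innerDs c ≤ 2 + countD x + countU y
    insertion-lo with 0 ℕₚ.<? countD y
    ... | yes d>0 = let (inner<g , _) , g≤ = All.lookupAny bounds low in s≤s (ℕₚ.≤-trans inner<g g≤)
      where
      low : Any (_≤ suc (countD x + countU y)) (heights (x ++ y))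
      low = subst (Any _) (sym (heights-++ x y)) (Anyₚ.++⁺ʳ _ (Anyₚ.map⁺
              (Any.map (λ {h} h≤ → subst (countD x + h ≤_) (ℕₚ.+-suc (countD x) (countU y))
                                          (ℕₚ.+-monoʳ-≤ (countD x) h≤))
                       (first-height y d>0))))
    ... | no d≯0 = s≤s (s≤s (ℕₚ.≤-trans (innerDs≤ c) (subst (_≤ countD x + countU y)
                      (sym (trans (countD-++ x y) (cong (countD x +_) (ℕₚ.n≤0⇒n≡0 (ℕₚ.≮⇒≥ d≯0)))))
                      (ℕₚ.+-monoʳ-≤ (countD x) z≤n))))

    insertion-hi : 2 + countD x + countU y ≤ 2 + leadingDs c + countU (x ++ y)
    insertion-hi with 0 ℕₚ.<? countD x
    ... | yes d>0 = let (_ , g≤) , ≤g = All.lookupAny bounds high in s≤s (s≤s (ℕₚ.≤-trans ≤g g≤))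
      where
      high : Any (countD x + countU y ≤_) (heights (x ++ y))
      high = subst (Any _) (sym (heights-++ x y)) (Anyₚ.++⁺ˡ (Anyₚ.map⁺
               (Any.map (λ {h} ≤h → subst (_≤ countU y + h) (ℕₚ.+-comm (countU y) (countD x))
                                           (ℕₚ.+-monoʳ-≤ (countU y) ≤h))
                        (last-height x d>0))))
    ... | no d≯0 rewrite ℕₚ.n≤0⇒n≡0 (ℕₚ.≮⇒≥ d≯0) =
      s≤s (s≤s (ℕₚ.≤-trans (subst (countU y ≤_) (sym (countU-++ x y)) (ℕₚ.m≤n+m (countU y) (countU x)))
                           (ℕₚ.m≤n+m _ (leadingDs c))))

  sorted-or-DU : ∀ w → (w ≡ U^ countU w ++ D^ countD w) ⊎ (∃₂ λ x y → w ≡ x ++ D ∷ U ∷ y)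
  sorted-or-DU [] = inj₁ refl
  sorted-or-DU (U ∷ w) with sorted-or-DU w
  ... | inj₁ sorted        = inj₁ (cong (U ∷_) sorted)
  ... | inj₂ (x , y , w≡) = inj₂ (U ∷ x , y , cong (U ∷_) w≡)
  sorted-or-DU (D ∷ w) with sorted-or-DU w
  ... | inj₂ (x , y , w≡) = inj₂ (D ∷ x , y , cong (D ∷_) w≡)
  ... | inj₁ sorted with countU w
  ...   | zero  = inj₁ (cong (D ∷_) sorted)
  ...   | suc u = inj₂ ([] , U^ u ++ D^ countD w , cong (D ∷_) sorted)

  sortedTail : ∀ u d → Tail u d (U^ u ++ D^ d)
  sortedTail u zero    = subst (Tail u 0) (sym (Listₚ.++-identityʳ (U^ u))) (core (allU u))
    where
    allU : ∀ u → Core u 0 (U^ u)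
    allU zero    = []
    allU (suc u) = U∷ allU u
  sortedTail u (suc d) =
    subst (Tail u (suc d)) (trans (Listₚ.++-assoc (U^ u) (D^ d) [ D ]) (cong (U^ u ++_) (D^-∷ʳ d)))
          (sortedTail u d ∷ʳD)
    where
    D^-∷ʳ : ∀ d → D^ d ∷ʳ D ≡ D^ suc d
    D^-∷ʳ zero    = refl
    D^-∷ʳ (suc d) = cong (D ∷_) (D^-∷ʳ d)

  CanonicalForm : Word → Set
  CanonicalForm w = ∃ λ r → Canonical (countU w) (countD w) r × heights r ↭ heights w

  mutual
    canonicalise : ∀ k w → countD w ≡ k → countD w ≤ countU w → CanonicalForm w
    canonicalise k w d≡k d≤u with sorted-or-DU w
    ... | inj₁ sorted = w , subst (Canonical _ _) (sym sorted) (tail (sortedTail _ _)) , ↭-refl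
    ... | inj₂ (x , y , refl) = canonicaliseDU k x y d≡k d≤u

    canonicaliseDU : ∀ k x y → let w = x ++ D ∷ U ∷ y in
      countD w ≡ k → countD w ≤ countU w → CanonicalForm w
    canonicaliseDU zero x y d≡0 _ = ⊥-elim (ℕₚ.1+n≢0 (trans (sym (countD-insert x (D ∷ U ∷ []) y)) d≡0))
    canonicaliseDU (suc k) x y d≡ d≤u =
      let r₀ , c₀ , p₀ = canonicalise k (x ++ y) d≡k d≤u′
          r , c , p = insertCanonical c₀ _ (insertion-lo x y c₀ p₀ d≤u′) (insertion-hi x y c₀ p₀ d≤u′)
      in r ,
         subst₂ (λ u d → Canonical u d r) (sym (countU-insert x DU y)) (sym (countD-insert x DU y)) c ,
         ↭-trans p (↭-trans (prep _ (↭ₚ.map⁺ suc p₀)) (↭-sym (heights-DU x y)))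
      where
      DU = D ∷ U ∷ []
      d≡k : countD (x ++ y) ≡ k
      d≡k = ℕₚ.suc-injective (trans (sym (countD-insert x DU y)) d≡)
      d≤u′ : countD (x ++ y) ≤ countU (x ++ y)
      d≤u′ = ℕₚ.≤-pred (subst₂ _≤_ (countD-insert x DU y) (countU-insert x DU y) d≤u)

module FreeAlgebra {c ℓ} (R : CommutativeRing c ℓ) where
  open CommutativeRing R
  open import Algebra.Properties.Ring ring
    using (-‿distribʳ-*; -1*x≈-x; -0#≈0#; //-rightDividesʳ; xyx⁻¹≈y; x∙y⁻¹≈ε⇒x≈y)
  import Algebra.Properties.CommutativeSemigroup +-commutativeSemigroup as +-CS
  open import Relation.Binary.Reasoning.Setoid setoid

  Poly : Set c
  Poly = FreeElt R

  ⟦_⟧ : Word → Poly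
  ⟦ w ⟧ = [ (1# , w) ]

  δ : Word → Word → Carrier → Carrier
  δ w v a with w ≟W v
  ... | yes _ = a
  ... | no  _ = 0#

  coeff-∷ : ∀ w a v p → coeff R w ((a , v) ∷ p) ≈ δ w v a + coeff R w p
  coeff-∷ w a v p with w ≟W v
  ... | yes _ = refl
  ... | no  _ = sym (+-identityˡ _)

  δ-same : ∀ v a → δ v v a ≈ a
  δ-same v a with v ≟W v
  ... | yes _  = refl
  ... | no v≢v = ⊥-elim (v≢v ≡.refl)

  δ-diff : ∀ w v a → w ≢ v → δ w v a ≈ 0#
  δ-diff w v a w≢v with w ≟W v
  ... | yes w≡v = ⊥-elim (w≢v w≡v)
  ... | no  _   = refl

  δ-cong : ∀ w v {a b} → a ≈ b → δ w v a ≈ δ w v b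
  δ-cong w v a≈b with w ≟W v
  ... | yes _ = a≈b
  ... | no  _ = refl

  δ-*ˡ : ∀ w v k a → δ w v (k * a) ≈ k * δ w v a
  δ-*ˡ w v k a with w ≟W v
  ... | yes _ = refl
  ... | no  _ = sym (zeroʳ k)

  δ-*ʳ : ∀ w v a → δ w v a ≈ δ w v 1# * a
  δ-*ʳ w v a with w ≟W v
  ... | yes _ = sym (*-identityˡ a)
  ... | no  _ = sym (zeroˡ a)

  δ-neg : ∀ w v a → δ w v (- a) ≈ - δ w v a
  δ-neg w v a with w ≟W v
  ... | yes _ = refl
  ... | no  _ = sym -0#≈0#

  coeff-++ : ∀ w p q → coeff R w (p ++ q) ≈ coeff R w p + coeff R w q
  coeff-++ w []            q = sym (+-identityˡ _)
  coeff-++ w ((a , v) ∷ p) q = begin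
    coeff R w ((a , v) ∷ p ++ q)          ≈⟨ coeff-∷ w a v (p ++ q) ⟩
    δ w v a + coeff R w (p ++ q)          ≈⟨ +-congˡ (coeff-++ w p q) ⟩
    δ w v a + (coeff R w p + coeff R w q) ≈⟨ +-assoc _ _ _ ⟨
    (δ w v a + coeff R w p) + coeff R w q ≈⟨ +-congʳ (coeff-∷ w a v p) ⟨
    coeff R w ((a , v) ∷ p) + coeff R w q ∎

  extend : (Word → Carrier) → Poly → Carrier
  extend φ []            = 0#
  extend φ ((a , v) ∷ p) = φ v * a + extend φ p

  extend-++ : ∀ (φ : Word → Carrier) p q → extend φ (p ++ q) ≈ extend φ p + extend φ q
  extend-++ φ []            q = sym (+-identityˡ _)
  extend-++ φ ((a , v) ∷ p) q = trans (+-congˡ (extend-++ φ p q)) (sym (+-assoc _ _ _))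

  sumOver : List Word → (Word → Carrier) → Carrier
  sumOver []      f = 0#
  sumOver (w ∷ S) f = f w + sumOver S f

  sumOver-cong : ∀ S {f g} → (∀ w → f w ≈ g w) → sumOver S f ≈ sumOver S g
  sumOver-cong []      f≈g = refl
  sumOver-cong (w ∷ S) f≈g = +-cong (f≈g w) (sumOver-cong S f≈g)

  sumOver-+ : ∀ S f g → sumOver S (λ w → f w + g w) ≈ sumOver S f + sumOver S g
  sumOver-+ []      f g = sym (+-identityˡ _)
  sumOver-+ (w ∷ S) f g = trans (+-congˡ (sumOver-+ S f g)) (+-CS.interchange _ _ _ _)

  sumOver-0 : ∀ S f → (∀ {w} → w ∈ S → f w ≈ 0#) → sumOver S f ≈ 0#
  sumOver-0 []      f f≈0 = refl
  sumOver-0 (w ∷ S) f f≈0 =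
    trans (+-cong (f≈0 (here ≡.refl)) (sumOver-0 S f (f≈0 ∘ there))) (+-identityˡ _)

  sumOver-δ : ∀ (φ : Word → Carrier) v a S → Unique S → v ∈ S → sumOver S (λ w → φ w * δ w v a) ≈ φ v * a
  sumOver-δ φ v a (w ∷ S) (v∉S ∷ _) (here ≡.refl) = begin
    φ v * δ v v a + sumOver S (λ w → φ w * δ w v a)
      ≈⟨ +-cong (*-congˡ (δ-same v a)) (sumOver-0 S _ λ w∈S → trans (*-congˡ
           (δ-diff _ v a λ w≡v → All.lookup v∉S w∈S (≡.sym w≡v))) (zeroʳ _)) ⟩
    φ v * a + 0#
      ≈⟨ +-identityʳ _ ⟩
    φ v * a ∎
  sumOver-δ φ v a (w ∷ S) (w∉S ∷ uniq) (there v∈S) = begin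
    φ w * δ w v a + sumOver S (λ w → φ w * δ w v a)
      ≈⟨ +-cong (trans (*-congˡ (δ-diff w v a (All.lookup w∉S v∈S))) (zeroʳ _))
                (sumOver-δ φ v a S uniq v∈S) ⟩
    0# + φ v * a
      ≈⟨ +-identityˡ _ ⟩
    φ v * a ∎

  words : Poly → List Word
  words = map proj₂

  extend-sumOver : ∀ (φ : Word → Carrier) p S → Unique S → (∀ {v} → v ∈ words p → v ∈ S) →
    extend φ p ≈ sumOver S (λ w → φ w * coeff R w p)
  extend-sumOver φ []            S _    _   = sym (sumOver-0 S _ λ _ → zeroʳ _)
  extend-sumOver φ ((a , v) ∷ p) S uniq p⊆S = begin
    φ v * a + extend φ p
      ≈⟨ +-cong (sym (sumOver-δ φ v a S uniq (p⊆S (here ≡.refl))))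
                (extend-sumOver φ p S uniq (p⊆S ∘ there)) ⟩
    sumOver S (λ w → φ w * δ w v a) + sumOver S (λ w → φ w * coeff R w p)
      ≈⟨ sumOver-+ S _ _ ⟨
    sumOver S (λ w → φ w * δ w v a + φ w * coeff R w p)
      ≈⟨ sumOver-cong S (λ w → trans (sym (distribˡ _ _ _)) (*-congˡ (sym (coeff-∷ w a v p)))) ⟩
    sumOver S (λ w → φ w * coeff R w ((a , v) ∷ p)) ∎

  infix 4 _≐_
  record _≐_ (p q : Poly) : Set ℓ where
    constructor mk≐
    field coeff≈ : ∀ w → coeff R w p ≈ coeff R w q
  open _≐_ public

  ≐-refl : ∀ {p} → p ≐ p
  ≐-refl = mk≐ λ _ → refl

  ≐-sym : ∀ {p q} → p ≐ q → q ≐ p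
  ≐-sym p≐q = mk≐ λ w → sym (coeff≈ p≐q w)

  ≐-trans : ∀ {p q r} → p ≐ q → q ≐ r → p ≐ r
  ≐-trans p≐q q≐r = mk≐ λ w → trans (coeff≈ p≐q w) (coeff≈ q≐r w)

  ≡⇒≐ : ∀ {p q} → p ≡ q → p ≐ q
  ≡⇒≐ ≡.refl = ≐-refl

  ++-cong≐ : ∀ {p p′ q q′} → p ≐ p′ → q ≐ q′ → p ++ q ≐ p′ ++ q′
  ++-cong≐ {p} {p′} {q} {q′} p≐p′ q≐q′ = mk≐ λ w →
    trans (coeff-++ w p q) (trans (+-cong (coeff≈ p≐p′ w) (coeff≈ q≐q′ w)) (sym (coeff-++ w p′ q′)))

  ++-interchange≐ : ∀ p q r s → (p ++ q) ++ (r ++ s) ≐ (p ++ r) ++ (q ++ s)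
  ++-interchange≐ p q r s = mk≐ λ w → begin
    coeff R w ((p ++ q) ++ (r ++ s))
      ≈⟨ trans (coeff-++ w (p ++ q) (r ++ s)) (+-cong (coeff-++ w p q) (coeff-++ w r s)) ⟩
    (coeff R w p + coeff R w q) + (coeff R w r + coeff R w s)
      ≈⟨ +-CS.interchange _ _ _ _ ⟩
    (coeff R w p + coeff R w r) + (coeff R w q + coeff R w s)
      ≈⟨ trans (coeff-++ w (p ++ r) (q ++ s)) (+-cong (coeff-++ w p r) (coeff-++ w q s)) ⟨
    coeff R w ((p ++ r) ++ (q ++ s)) ∎

  -- Both sides are sums over the distinct words occurring in p or q.
  extend-cong : ∀ (φ : Word → Carrier) {p q} → p ≐ q → extend φ p ≈ extend φ q
  extend-cong φ {p} {q} p≐q = begin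
    extend φ p                           ≈⟨ extend-sumOver φ p S uniq (∈S ∘ ∈ₚ.∈-++⁺ˡ) ⟩
    sumOver S (λ w → φ w * coeff R w p)  ≈⟨ sumOver-cong S (λ w → *-congˡ (coeff≈ p≐q w)) ⟩
    sumOver S (λ w → φ w * coeff R w q)  ≈⟨ extend-sumOver φ q S uniq (∈S ∘ ∈ₚ.∈-++⁺ʳ (words p)) ⟨
    extend φ q                           ∎
    where
    S = deduplicate _≟W_ (words p ++ words q)
    uniq : Unique S
    uniq = Uniqueₚ.deduplicate-! _≟W_ (words p ++ words q)
    ∈S : ∀ {v} → v ∈ words p ++ words q → v ∈ S
    ∈S = ∈ₚ.∈-deduplicate⁺ _≟W_

  infixr 7 _·_ _◃_

  _·_ : Carrier → Poly → Poly
  k · p = map (map₁ (k *_)) p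

  _◃_ : Word → Poly → Poly
  u ◃ p = map (map₂ (u ++_)) p

  coeff-· : ∀ w k p → coeff R w (k · p) ≈ k * coeff R w p
  coeff-· w k []            = sym (zeroʳ k)
  coeff-· w k ((a , v) ∷ p) = begin
    coeff R w ((k * a , v) ∷ k · p)  ≈⟨ coeff-∷ w (k * a) v (k · p) ⟩
    δ w v (k * a) + coeff R w (k · p) ≈⟨ +-cong (δ-*ˡ w v k a) (coeff-· w k p) ⟩
    k * δ w v a + k * coeff R w p    ≈⟨ distribˡ k _ _ ⟨
    k * (δ w v a + coeff R w p)      ≈⟨ *-congˡ (coeff-∷ w a v p) ⟨
    k * coeff R w ((a , v) ∷ p)      ∎

  coeff-◃ : ∀ w u p → coeff R w (u ◃ p) ≈ extend (λ v → δ w (u ++ v) 1#) p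
  coeff-◃ w u []            = refl
  coeff-◃ w u ((a , v) ∷ p) =
    trans (coeff-∷ w a (u ++ v) (u ◃ p)) (+-cong (δ-*ʳ w (u ++ v) a) (coeff-◃ w u p))

  ·-cong : ∀ k {p q} → p ≐ q → k · p ≐ k · q
  ·-cong k {p} {q} p≐q = mk≐ λ w →
    trans (coeff-· w k p) (trans (*-congˡ (coeff≈ p≐q w)) (sym (coeff-· w k q)))

  ·-congʳ : ∀ {k k′} p → k ≈ k′ → k · p ≐ k′ · p
  ·-congʳ {k} {k′} p k≈k′ = mk≐ λ w → trans (coeff-· w k p) (trans (*-congʳ k≈k′) (sym (coeff-· w k′ p)))

  ·-identity : ∀ p → 1# · p ≐ p
  ·-identity p = mk≐ λ w → trans (coeff-· w 1# p) (*-identityˡ _)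

  ◃-cong : ∀ u {p q} → p ≐ q → u ◃ p ≐ u ◃ q
  ◃-cong u {p} {q} p≐q = mk≐ λ w → trans (coeff-◃ w u p) (trans (extend-cong _ p≐q) (sym (coeff-◃ w u q)))

  ◃-++ : ∀ u p q → u ◃ (p ++ q) ≡ u ◃ p ++ u ◃ q
  ◃-++ u p q = Listₚ.map-++ _ p q

  ·-++ : ∀ k p q → k · (p ++ q) ≡ k · p ++ k · q
  ·-++ k p q = Listₚ.map-++ _ p q

  ◃-◃ : ∀ u v p → u ◃ v ◃ p ≡ (u ++ v) ◃ p
  ◃-◃ u v []            = ≡.refl
  ◃-◃ u v ((a , w) ∷ p) = ≡.cong₂ _∷_ (≡.cong (a ,_) (≡.sym (Listₚ.++-assoc u v w))) (◃-◃ u v p)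

  []◃ : ∀ p → [] ◃ p ≡ p
  []◃ []      = ≡.refl
  []◃ (m ∷ p) = ≡.cong (m ∷_) ([]◃ p)

  ◃-· : ∀ u k p → u ◃ k · p ≡ k · u ◃ p
  ◃-· u k []      = ≡.refl
  ◃-· u k (m ∷ p) = ≡.cong (_ ∷_) (◃-· u k p)

  Generators : Set c
  Generators = List (Carrier × Word × Word)

  G : Generators → Poly
  G = concatMap (generator R)

  G-++ : ∀ gs hs → G (gs ++ hs) ≡ G gs ++ G hs
  G-++ []       hs = ≡.refl
  G-++ (g ∷ gs) hs = ≡.trans (≡.cong (generator R g ++_) (G-++ gs hs))
                             (≡.sym (Listₚ.++-assoc (generator R g) (G gs) (G hs)))

  ∷-cong≐ : ∀ {a b} v {p q} → a ≈ b → p ≐ q → (a , v) ∷ p ≐ (b , v) ∷ q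
  ∷-cong≐ v {p} {q} a≈b p≐q = mk≐ λ w →
    trans (coeff-∷ w _ v p) (trans (+-cong (δ-cong w v a≈b) (coeff≈ p≐q w)) (sym (coeff-∷ w _ v q)))

  G-· : ∀ k gs → G (map (map₁ (k *_)) gs) ≐ k · G gs
  G-· k []                 = ≐-refl
  G-· k ((x , a , b) ∷ gs) =
    ∷-cong≐ _ refl (∷-cong≐ _ (-‿distribʳ-* k x) (∷-cong≐ _ (-‿distribʳ-* k x) (G-· k gs)))

  ◃-G : ∀ u gs → u ◃ G gs ≡ G (map (λ (x , a , b) → x , u ++ a , b) gs)
  ◃-G u []                 = ≡.refl
  ◃-G u ((x , a , b) ∷ gs) = ≡.cong₂ _++_
    (≡.cong₂ _∷_ (≡.cong (x ,_) (≡.sym (Listₚ.++-assoc u a _)))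
    (≡.cong₂ _∷_ (≡.cong (- x ,_) (≡.sym (Listₚ.++-assoc u a _)))
                 (≡.cong (λ w → [ (- x , w) ]) (≡.sym (Listₚ.++-assoc u a b)))))
    (◃-G u gs)

  infix 4 _∼_
  _∼_ : Poly → Poly → Set (c ⊔ ℓ)
  p ∼ q = Σ Generators λ gs → p ≐ q ++ G gs

  ≐⇒∼ : ∀ {p q} → p ≐ q → p ∼ q
  ≐⇒∼ {p} {q} p≐q = [] , ≐-trans p≐q (≡⇒≐ (≡.sym (Listₚ.++-identityʳ q)))

  ∼-refl : ∀ {p} → p ∼ p
  ∼-refl = ≐⇒∼ ≐-refl

  ∼-trans : ∀ {p q r} → p ∼ q → q ∼ r → p ∼ r
  ∼-trans {r = r} (gs , p≐q+) (hs , q≐r+) = hs ++ gs , ≐-trans p≐q+ (≐-trans (++-cong≐ q≐r+ ≐-refl)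
    (≡⇒≐ (≡.trans (Listₚ.++-assoc r (G hs) (G gs)) (≡.cong (r ++_) (≡.sym (G-++ hs gs))))))

  ∼-sym : ∀ {p q} → p ∼ q → q ∼ p
  ∼-sym {p} {q} (gs , p≐q+) = map (map₁ (- 1# *_)) gs , mk≐ λ w → begin
    coeff R w q
      ≈⟨ //-rightDividesʳ (coeff R w (G gs)) (coeff R w q) ⟨
    (coeff R w q + coeff R w (G gs)) - coeff R w (G gs)
      ≈⟨ +-congʳ (trans (coeff≈ p≐q+ w) (coeff-++ w q (G gs))) ⟨
    coeff R w p - coeff R w (G gs)
      ≈⟨ +-congˡ (trans (coeff-· w (- 1#) (G gs)) (-1*x≈-x _)) ⟨
    coeff R w p + coeff R w (- 1# · G gs)
      ≈⟨ +-congˡ (coeff≈ (G-· (- 1#) gs) w) ⟨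
    coeff R w p + coeff R w (G (map (map₁ (- 1# *_)) gs))
      ≈⟨ coeff-++ w p _ ⟨
    coeff R w (p ++ G (map (map₁ (- 1# *_)) gs)) ∎

  ∼-++ : ∀ {p q p′ q′} → p ∼ q → p′ ∼ q′ → p ++ p′ ∼ q ++ q′
  ∼-++ {q = q} {q′ = q′} (gs , p≐) (gs′ , p′≐) = gs ++ gs′ ,
    ≐-trans (++-cong≐ p≐ p′≐) (≐-trans (++-interchange≐ q (G gs) q′ (G gs′))
      (≡⇒≐ (≡.cong ((q ++ q′) ++_) (≡.sym (G-++ gs gs′)))))

  ∼-· : ∀ k {p q} → p ∼ q → k · p ∼ k · q
  ∼-· k {q = q} (gs , p≐) = map (map₁ (k *_)) gs ,
    ≐-trans (·-cong k p≐) (≐-trans (≡⇒≐ (·-++ k q (G gs))) (++-cong≐ ≐-refl (≐-sym (G-· k gs))))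

  ∼-◃ : ∀ u {p q} → p ∼ q → u ◃ p ∼ u ◃ q
  ∼-◃ u {q = q} (gs , p≐) = map (λ (x , a , b) → x , u ++ a , b) gs ,
    ≐-trans (◃-cong u p≐) (≡⇒≐ (≡.trans (◃-++ u q (G gs)) (≡.cong (u ◃ q ++_) (◃-G u gs))))

  ∼-isEquivalence : IsEquivalence _∼_
  ∼-isEquivalence = record { refl = ∼-refl ; sym = ∼-sym ; trans = ∼-trans }

  ∼-setoid : Setoid c (c ⊔ ℓ)
  ∼-setoid = record { isEquivalence = ∼-isEquivalence }

  module ∼-Reasoning = SetoidReasoning ∼-setoid

  coeff-⟦⟧ : ∀ w u → coeff R w ⟦ u ⟧ ≈ δ w u 1#
  coeff-⟦⟧ w u = trans (coeff-∷ w 1# u []) (+-identityʳ _)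

  private
    ACR = fromCommutativeRing R (λ _ → nothing)
    module A = AlmostCommutativeRing ACR

    rearrange : ∀ (a b c nb nc : A.Carrier) →
      b A.+ (c A.+ (a A.+ (nb A.+ nc))) A.≈ a A.+ ((b A.+ nb) A.+ (c A.+ nc))
    rearrange = solve-∀ ACR

  DU-monomial : ∀ x v → [ (x , D ∷ U ∷ v) ] ∼ (x , U ∷ D ∷ v) ∷ [ (x , v) ]
  DU-monomial x v = [ (x , [] , v) ] , mk≐ λ w →
    let A = δ w (D ∷ U ∷ v) x ; B = δ w (U ∷ D ∷ v) x ; C = δ w v x in begin
    coeff R w [ (x , D ∷ U ∷ v) ]
      ≈⟨ trans (coeff-∷ w x _ []) (+-identityʳ _) ⟩
    A
      ≈⟨ trans (+-congˡ (+-identityʳ 0#)) (+-identityʳ A) ⟨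
    A + (0# + 0#)
      ≈⟨ +-congˡ (+-cong (-‿inverseʳ B) (-‿inverseʳ C)) ⟨
    A + ((B - B) + (C - C))
      ≈⟨ rearrange A B C (- B) (- C) ⟨
    B + (C + (A + (- B + - C)))
      ≈⟨ +-congˡ (+-congˡ (+-congˡ (+-cong (δ-neg w _ x) (trans (+-identityʳ _) (δ-neg w v x))))) ⟨
    B + (C + (A + (δ w (U ∷ D ∷ v) (- x) + (δ w v (- x) + 0#))))
      ≈⟨ trans (coeff-∷ w _ _ _) (+-congˡ (trans (coeff-∷ w _ _ _) (+-congˡ (trans (coeff-∷ w _ _ _)
           (+-congˡ (trans (coeff-∷ w _ _ _) (+-congˡ (coeff-∷ w _ _ _)))))))) ⟨
    coeff R w ((x , U ∷ D ∷ v) ∷ (x , v) ∷ generator R (x , [] , v)) ∎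

  DU-relation : ∀ P → (D ∷ U ∷ []) ◃ P ∼ (U ∷ D ∷ []) ◃ P ++ P
  DU-relation []            = ∼-refl
  DU-relation ((x , v) ∷ P) = ∼-trans (∼-++ (DU-monomial x v) (DU-relation P))
    (≐⇒∼ (++-interchange≐ [ (x , U ∷ D ∷ v) ] [ (x , v) ] ((U ∷ D ∷ []) ◃ P) P))

  ∼⇒WeylEq : ∀ {u v} → ⟦ u ⟧ ∼ ⟦ v ⟧ → WeylEq R u v
  ∼⇒WeylEq {u} {v} (gs , u≐) = gs , λ w → begin
    coeff R w ((1# , u) ∷ (- 1# , v) ∷ [])
      ≈⟨ trans (coeff-∷ w 1# u _)
               (+-congˡ (trans (coeff-∷ w (- 1#) v []) (trans (+-identityʳ _) (δ-neg w v 1#)))) ⟩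
    δ w u 1# - δ w v 1#
      ≈⟨ +-congʳ (trans (sym (coeff-⟦⟧ w u))
                 (trans (coeff≈ u≐ w) (trans (coeff-++ w ⟦ v ⟧ (G gs)) (+-congʳ (coeff-⟦⟧ w v))))) ⟩
    (δ w v 1# + coeff R w (G gs)) - δ w v 1#
      ≈⟨ xyx⁻¹≈y _ _ ⟩
    coeff R w (G gs) ∎

  module _ (φ : Word → Carrier)
           (φ-DU : ∀ a b → φ (a ++ D ∷ U ∷ b) ≈ φ (a ++ U ∷ D ∷ b) + φ (a ++ b)) where

    extend-generator : ∀ g → extend φ (generator R g) ≈ 0#
    extend-generator (x , a , b) = begin
      φ (a ++ D ∷ U ∷ b) * x + (φ (a ++ U ∷ D ∷ b) * - x + (φ (a ++ b) * - x + 0#))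
        ≈⟨ +-cong (trans (*-congʳ (φ-DU a b)) (distribʳ x _ _))
                  (+-cong (sym (-‿distribʳ-* _ x)) (trans (+-identityʳ _) (sym (-‿distribʳ-* _ x)))) ⟩
      (φ₁ * x + φ₂ * x) + (- (φ₁ * x) + - (φ₂ * x))
        ≈⟨ +-CS.interchange _ _ _ _ ⟩
      (φ₁ * x - φ₁ * x) + (φ₂ * x - φ₂ * x)
        ≈⟨ +-cong (-‿inverseʳ _) (-‿inverseʳ _) ⟩
      0# + 0#
        ≈⟨ +-identityʳ 0# ⟩
      0# ∎
      where
      φ₁ = φ (a ++ U ∷ D ∷ b)
      φ₂ = φ (a ++ b)

    extend-G : ∀ gs → extend φ (G gs) ≈ 0#
    extend-G []       = refl
    extend-G (g ∷ gs) =
      trans (extend-++ φ (generator R g) (G gs))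
            (trans (+-cong (extend-generator g) (extend-G gs)) (+-identityʳ 0#))

    WeylEq⇒≈ : ∀ {u v} → WeylEq R u v → φ u ≈ φ v
    WeylEq⇒≈ {u} {v} (gs , coeffs≈) = x∙y⁻¹≈ε⇒x≈y (φ u) (φ v) (begin
      φ u - φ v
        ≈⟨ +-cong (*-identityʳ _) (trans (+-identityʳ _) (trans (sym (-‿distribʳ-* _ 1#))
                                                                (-‿cong (*-identityʳ _)))) ⟨
      φ u * 1# + (φ v * - 1# + 0#)
        ≈⟨ extend-cong φ {(1# , u) ∷ (- 1# , v) ∷ []} {G gs} (mk≐ coeffs≈) ⟩
      extend φ (G gs)
        ≈⟨ extend-G gs ⟩
      0# ∎)

module Invariant {c ℓ} (R : CommutativeRing c ℓ) where
  open CommutativeRing R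
  open import Algebra.Properties.Ring ring using (xyx⁻¹≈y; -‿+-comm; //-rightDividesʳ)
  import Algebra.Properties.CommutativeSemigroup +-commutativeSemigroup as +-CS
  open import Relation.Binary.Reasoning.Setoid setoid
  open FreeAlgebra R
  open Words
  open ShiftedProducts

  ι : ℕ → Carrier
  ι n = _•_ R n 1#

  ι-+ : ∀ m n → ι (m Nat.+ n) ≈ ι m + ι n
  ι-+ zero    n = sym (+-identityˡ _)
  ι-+ (suc m) n = trans (+-congˡ (ι-+ m n)) (sym (+-assoc _ _ _))

  ι-* : ∀ m n → ι (m Nat.* n) ≈ ι m * ι n
  ι-* zero    n = sym (zeroˡ _)
  ι-* (suc m) n = begin
    ι (n Nat.+ m Nat.* n)        ≈⟨ ι-+ n (m Nat.* n) ⟩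
    ι n + ι (m Nat.* n)        ≈⟨ +-cong (sym (*-identityˡ _)) (ι-* m n) ⟩
    1# * ι n + ι m * ι n     ≈⟨ distribʳ _ _ _ ⟨
    (1# + ι m) * ι n         ∎

  ι-cancel : CharZero R → ∀ {m n} → m ≤ n → ι n ≈ ι m → n ≡ m
  ι-cancel char0 {m} {n} m≤n ιn≈ιm =
    ≡.trans (≡.sym (ℕₚ.m+[n∸m]≡n m≤n))
            (≡.trans (≡.cong (m Nat.+_) (char0 (n ∸ m) ι[n-m]≈0)) (ℕₚ.+-identityʳ m))
    where
    m+[n∸m]≡n = ℕₚ.m+[n∸m]≡n m≤n
    ι[n-m]≈0 : ι (n ∸ m) ≈ 0#
    ι[n-m]≈0 = begin
      ι (n ∸ m)               ≈⟨ xyx⁻¹≈y (ι m) (ι (n ∸ m)) ⟨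
      ι m + ι (n ∸ m) - ι m   ≈⟨ +-congʳ (trans (sym (ι-+ m (n ∸ m))) (reflexive (≡.cong ι m+[n∸m]≡n))) ⟩
      ι n - ι m               ≈⟨ +-congʳ ιn≈ιm ⟩
      ι m - ι m               ≈⟨ -‿inverseʳ (ι m) ⟩
      0#                      ∎

  ι-injective : CharZero R → ∀ m n → ι m ≈ ι n → m ≡ n
  ι-injective char0 m n ιm≈ιn with ℕₚ.≤-total m n
  ... | inj₁ m≤n = ≡.sym (ι-cancel char0 m≤n (sym ιm≈ιn))
  ... | inj₂ n≤m = ι-cancel char0 n≤m ιm≈ιn

  private
    ACR = fromCommutativeRing R (λ _ → nothing)
    module A = AlmostCommutativeRing ACR

    rearrange-1 : ∀ (e u nd : A.Carrier) → (e A.+ (A.1# A.+ u)) A.+ nd A.≈ ((e A.+ u) A.+ nd) A.+ A.1#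
    rearrange-1 = solve-∀ ACR

    rearrange-2 : ∀ (e u nd n1 : A.Carrier) →
      (e A.+ (A.1# A.+ u)) A.+ (n1 A.+ nd) A.≈ ((e A.+ u) A.+ nd) A.+ (A.1# A.+ n1)
    rearrange-2 = solve-∀ ACR

  factor : Carrier → Word → Carrier
  factor e w = e + ι (countU w) - ι (countD w)

  -- In the representation D = d/dt, U = t, a word w maps tᵉ to act e w · tᵉ⁺ᵘ⁻ᵈ
  -- (e a formal exponent, u and d the numbers of letters U and D in w).
  act : Carrier → Word → Carrier
  act e []      = 1#
  act e (U ∷ w) = act e w
  act e (D ∷ w) = factor e w * act e w

  factor-insert : ∀ e a x b → countU x ≡ 1 → countD x ≡ 1 → factor e (a ++ x ++ b) ≈ factor e (a ++ b)
  factor-insert e a x b u≡1 d≡1 = begin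
    e + ι (countU (a ++ x ++ b)) - ι (countD (a ++ x ++ b))
      ≈⟨ reflexive (≡.cong₂ (λ u d → e + ι u - ι d)
                            (≡.trans (countU-insert a x b) (≡.cong (Nat._+ _) u≡1))
                            (≡.trans (countD-insert a x b) (≡.cong (Nat._+ _) d≡1))) ⟩
    e + (1# + ι u) - (1# + ι d)
      ≈⟨ +-congˡ (-‿+-comm 1# (ι d)) ⟨
    e + (1# + ι u) + (- 1# + - ι d)
      ≈⟨ rearrange-2 e (ι u) (- ι d) (- 1#) ⟩
    e + ι u - ι d + (1# - 1#)
      ≈⟨ +-congˡ (-‿inverseʳ 1#) ⟩
    e + ι u - ι d + 0#
      ≈⟨ +-identityʳ _ ⟩
    e + ι u - ι d ∎
    where
    u = countU (a ++ b)
    d = countD (a ++ b)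

  act-DU : ∀ e a b → act e (a ++ D ∷ U ∷ b) ≈ act e (a ++ U ∷ D ∷ b) + act e (a ++ b)
  act-DU e [] b = begin
    (e + (1# + ι (countU b)) - ι (countD b)) * act e b
      ≈⟨ *-congʳ (rearrange-1 e (ι (countU b)) (- ι (countD b))) ⟩
    (factor e b + 1#) * act e b
      ≈⟨ distribʳ _ _ _ ⟩
    factor e b * act e b + 1# * act e b
      ≈⟨ +-congˡ (*-identityˡ _) ⟩
    factor e b * act e b + act e b ∎
  act-DU e (U ∷ a) b = act-DU e a b
  act-DU e (D ∷ a) b = begin
    factor e (a ++ D ∷ U ∷ b) * act e (a ++ D ∷ U ∷ b)
      ≈⟨ *-cong (factor-insert e a (D ∷ U ∷ []) b ≡.refl ≡.refl) (act-DU e a b) ⟩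
    factor e (a ++ b) * (act e (a ++ U ∷ D ∷ b) + act e (a ++ b))
      ≈⟨ distribˡ _ _ _ ⟩
    factor e (a ++ b) * act e (a ++ U ∷ D ∷ b) + factor e (a ++ b) * act e (a ++ b)
      ≈⟨ +-congʳ (*-congʳ (factor-insert e a (U ∷ D ∷ []) b ≡.refl ≡.refl)) ⟨
    factor e (a ++ U ∷ D ∷ b) * act e (a ++ U ∷ D ∷ b) + factor e (a ++ b) * act e (a ++ b) ∎

  -- At e = N + 1 + (number of D), the factor of each D is N + 1 + its height.
  act-heights : ∀ N w → act (ι (suc N Nat.+ countD w)) w ≈ ι (shiftedProduct N (heights w))
  act-heights N []      = sym (+-identityʳ 1#)
  act-heights N (U ∷ w) = act-heights N w
  act-heights N (D ∷ w) = begin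
    factor (ι (suc N Nat.+ suc (countD w))) w * act (ι (suc N Nat.+ suc (countD w))) w
      ≈⟨ *-cong factor≈ (trans (reflexive (≡.cong (λ n → act (ι n) w) (ℕₚ.+-suc (suc N) (countD w))))
                               (act-heights (suc N) w)) ⟩
    ι (suc (suc N) Nat.+ countU w) * ι (shiftedProduct (suc N) (heights w))
      ≈⟨ ι-* (suc (suc N) Nat.+ countU w) (shiftedProduct (suc N) (heights w)) ⟨
    ι ((suc (suc N) Nat.+ countU w) Nat.* shiftedProduct (suc N) (heights w))
      ≈⟨ reflexive (≡.cong ι (≡.cong₂ Nat._*_ (≡.sym (ℕₚ.+-suc (suc N) (countU w)))
                                               (≡.sym (shiftedProduct-map-suc N (heights w))))) ⟩
    ι (shiftedProduct N (heights (D ∷ w))) ∎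
    where
    factor≈ : factor (ι (suc N Nat.+ suc (countD w))) w ≈ ι (suc (suc N) Nat.+ countU w)
    factor≈ = begin
      ι (suc N Nat.+ suc (countD w)) + ι (countU w) - ι (countD w)
        ≈⟨ +-congʳ (+-congʳ (trans (reflexive (≡.cong ι (ℕₚ.+-suc (suc N) (countD w))))
                                   (ι-+ (suc (suc N)) (countD w)))) ⟩
      ι (suc (suc N)) + ι (countD w) + ι (countU w) - ι (countD w)
        ≈⟨ trans (+-congʳ (+-CS.xy∙z≈xz∙y _ _ _)) (//-rightDividesʳ _ _) ⟩
      ι (suc (suc N)) + ι (countU w)
        ≈⟨ ι-+ (suc (suc N)) (countU w) ⟨
      ι (suc (suc N) Nat.+ countU w) ∎

  WeylEq⇒heights↭ : CharZero R → ∀ {u v} → countD u ≡ countD v → WeylEq R u v → heights u ↭ heights v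
  WeylEq⇒heights↭ char0 {u} {v} d≡ u~v = shiftedProduct-injective (heights u) (heights v) λ N →
    ι-injective char0 _ _ (begin
      ι (shiftedProduct N (heights u))       ≈⟨ act-heights N u ⟨
      act (ι (suc N Nat.+ countD u)) u       ≈⟨ WeylEq⇒≈ (act _) (act-DU _) u~v ⟩
      act (ι (suc N Nat.+ countD u)) v       ≈⟨ reflexive (≡.cong (λ d → act (ι (suc N Nat.+ d)) v) d≡) ⟩
      act (ι (suc N Nat.+ countD v)) v       ≈⟨ act-heights N v ⟩
      ι (shiftedProduct N (heights v))       ∎)

module NormalForm {c ℓ} (R : CommutativeRing c ℓ) where
  open CommutativeRing R
  import Algebra.Properties.CommutativeSemigroup *-commutativeSemigroup as *-CS
  import Algebra.Properties.CommutativeSemigroup +-commutativeSemigroup as +-CS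
  import Relation.Binary.Reasoning.Setoid setoid as ≈-Reasoning
  open FreeAlgebra R
  open import Algebra.Properties.Ring ring using (-‿+-comm; //-rightDividesʳ)
  open Invariant R using (ι; ι-+)
  open Words

  UD : Word
  UD = U ∷ D ∷ []

  θ+ : Carrier → Poly → Poly
  θ+ k p = UD ◃ p ++ k · p

  Θ : (ℕ → Carrier) → List ℕ → Poly → Poly
  Θ f gs p = foldr (λ g → θ+ (f g)) p gs

  θ+-cong : ∀ k {p q} → p ≐ q → θ+ k p ≐ θ+ k q
  θ+-cong k p≐q = ++-cong≐ (◃-cong UD p≐q) (·-cong k p≐q)

  θ+-congˡ : ∀ {k k′} p → k ≈ k′ → θ+ k p ≐ θ+ k′ p
  θ+-congˡ p k≈k′ = ++-cong≐ ≐-refl (·-congʳ p k≈k′)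

  θ+-cong∼ : ∀ k {p q} → p ∼ q → θ+ k p ∼ θ+ k q
  θ+-cong∼ k p∼q = ∼-++ (∼-◃ UD p∼q) (∼-· k p∼q)

  coeff-θ+ : ∀ w k p → coeff R w (θ+ k p) ≈ coeff R w (UD ◃ p) + k * coeff R w p
  coeff-θ+ w k p = trans (coeff-++ w (UD ◃ p) (k · p)) (+-congˡ (coeff-· w k p))

  θθ-comm : ∀ x y z a b → (x + b * y) + a * (y + b * z) ≈ (x + a * y) + b * (y + a * z)
  θθ-comm x y z a b = begin
    (x + b * y) + a * (y + b * z)       ≈⟨ +-congˡ (distribˡ a y (b * z)) ⟩
    (x + b * y) + (a * y + a * (b * z)) ≈⟨ +-CS.interchange x (b * y) (a * y) (a * (b * z)) ⟩
    (x + a * y) + (b * y + a * (b * z)) ≈⟨ +-congˡ (+-congˡ (*-CS.x∙yz≈y∙xz a b z)) ⟩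
    (x + a * y) + (b * y + b * (a * z)) ≈⟨ +-congˡ (distribˡ b y (a * z)) ⟨
    (x + a * y) + b * (y + a * z)       ∎
    where open ≈-Reasoning

  θ+-comm : ∀ a b p → θ+ a (θ+ b p) ≐ θ+ b (θ+ a p)
  θ+-comm a b p = mk≐ λ w → begin
    coeff R w (θ+ a (θ+ b p))
      ≈⟨ trans (coeff-θ+ w a (θ+ b p)) (+-cong (coeff-UD◃θ+ b) (*-congˡ (coeff-θ+ w b p))) ⟩
    (X w + b * Y w) + a * (Y w + b * Z w)
      ≈⟨ θθ-comm (X w) (Y w) (Z w) a b ⟩
    (X w + a * Y w) + b * (Y w + a * Z w)
      ≈⟨ trans (coeff-θ+ w b (θ+ a p)) (+-cong (coeff-UD◃θ+ a) (*-congˡ (coeff-θ+ w a p))) ⟨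
    coeff R w (θ+ b (θ+ a p)) ∎
    where
    open ≈-Reasoning
    X Y Z : Word → Carrier
    X w = coeff R w (UD ◃ UD ◃ p)
    Y w = coeff R w (UD ◃ p)
    Z w = coeff R w p
    coeff-UD◃θ+ : ∀ {w} k → coeff R w (UD ◃ θ+ k p) ≈ X w + k * Y w
    coeff-UD◃θ+ {w} k = trans (reflexive (≡.cong (coeff R w) (≡.trans (◃-++ UD (UD ◃ p) (k · p))
                          (≡.cong (UD ◃ UD ◃ p ++_) (◃-· UD k p))))) (coeff-θ+ w k (UD ◃ p))

  Θ-cong∼ : ∀ f gs {p q} → p ∼ q → Θ f gs p ∼ Θ f gs q
  Θ-cong∼ f []       p∼q = p∼q
  Θ-cong∼ f (g ∷ gs) p∼q = θ+-cong∼ (f g) (Θ-cong∼ f gs p∼q)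

  Θ-cong-fun : ∀ {f f′} → (∀ g → f g ≈ f′ g) → ∀ gs p → Θ f gs p ≐ Θ f′ gs p
  Θ-cong-fun         f≈f′ []       p = ≐-refl
  Θ-cong-fun {f} {f′} f≈f′ (g ∷ gs) p =
    ≐-trans (θ+-cong (f g) (Θ-cong-fun f≈f′ gs p)) (θ+-congˡ (Θ f′ gs p) (f≈f′ g))

  Θ-↭ : ∀ f p {gs gs′} → gs ↭ gs′ → Θ f gs p ≐ Θ f gs′ p
  Θ-↭ f p Perm.refl          = ≐-refl
  Θ-↭ f p (prep g q)         = θ+-cong (f g) (Θ-↭ f p q)
  Θ-↭ f p (swap {xs} g h q)  =
    ≐-trans (θ+-comm (f g) (f h) (Θ f xs p)) (θ+-cong (f h) (θ+-cong (f g) (Θ-↭ f p q)))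
  Θ-↭ f p (Perm.trans q q′)  = ≐-trans (Θ-↭ f p q) (Θ-↭ f p q′)

  Θ-map : ∀ f h gs p → Θ f (map h gs) p ≡ Θ (λ g → f (h g)) gs p
  Θ-map f h []       p = ≡.refl
  Θ-map f h (g ∷ gs) p = ≡.cong (θ+ (f (h g))) (Θ-map f h gs p)

  Θ-∷ʳ : ∀ f gs g p → Θ f (gs ∷ʳ g) p ≡ Θ f gs (θ+ (f g) p)
  Θ-∷ʳ f gs g p = Listₚ.foldr-++ (λ g → θ+ (f g)) p gs [ g ]

  absorb : ∀ p q k → (p ++ q) ++ k · q ≐ p ++ (k + 1#) · q
  absorb p q k = mk≐ λ w → begin
    coeff R w ((p ++ q) ++ k · q)
      ≈⟨ trans (coeff-++ w (p ++ q) (k · q)) (+-cong (coeff-++ w p q) (coeff-· w k q)) ⟩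
    (coeff R w p + coeff R w q) + k * coeff R w q
      ≈⟨ +-assoc _ _ _ ⟩
    coeff R w p + (coeff R w q + k * coeff R w q)
      ≈⟨ +-congˡ (trans (+-comm _ _) (+-congˡ (sym (*-identityˡ _)))) ⟩
    coeff R w p + (k * coeff R w q + 1# * coeff R w q)
      ≈⟨ +-congˡ (distribʳ _ k 1#) ⟨
    coeff R w p + (k + 1#) * coeff R w q
      ≈⟨ trans (coeff-++ w p ((k + 1#) · q)) (+-congˡ (coeff-· w (k + 1#) q)) ⟨
    coeff R w (p ++ (k + 1#) · q) ∎
    where open ≈-Reasoning

  U◃θ+ : ∀ k p → [ U ] ◃ θ+ (k + 1#) p ∼ θ+ k ([ U ] ◃ p)
  U◃θ+ k p = begin
    [ U ] ◃ θ+ (k + 1#) p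
      ≡⟨ ≡.trans (◃-++ [ U ] (UD ◃ p) ((k + 1#) · p))
                 (≡.cong₂ _++_ (◃-◃ [ U ] UD p) (◃-· [ U ] (k + 1#) p)) ⟩
    (U ∷ U ∷ D ∷ []) ◃ p ++ (k + 1#) · [ U ] ◃ p
      ≈⟨ ≐⇒∼ (absorb ((U ∷ U ∷ D ∷ []) ◃ p) ([ U ] ◃ p) k) ⟨
    ((U ∷ U ∷ D ∷ []) ◃ p ++ [ U ] ◃ p) ++ k · [ U ] ◃ p
      ≡⟨ ≡.cong (_++ k · [ U ] ◃ p) (≡.trans (≡.cong (_++ [ U ] ◃ p) (≡.sym (◃-◃ [ U ] UD p)))
                                             (≡.sym (◃-++ [ U ] (UD ◃ p) p))) ⟩
    [ U ] ◃ (UD ◃ p ++ p) ++ k · [ U ] ◃ p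
      ≈⟨ ∼-++ (∼-◃ [ U ] (DU-relation p)) ∼-refl ⟨
    [ U ] ◃ (D ∷ U ∷ []) ◃ p ++ k · [ U ] ◃ p
      ≡⟨ ≡.cong (_++ k · [ U ] ◃ p) (≡.trans (◃-◃ [ U ] (D ∷ U ∷ []) p) (≡.sym (◃-◃ UD [ U ] p))) ⟩
    θ+ k ([ U ] ◃ p) ∎
    where open ∼-Reasoning

  D◃θ+ : ∀ k p → [ D ] ◃ θ+ k p ∼ θ+ (k + 1#) ([ D ] ◃ p)
  D◃θ+ k p = begin
    [ D ] ◃ θ+ k p
      ≡⟨ ≡.trans (◃-++ [ D ] (UD ◃ p) (k · p))
                 (≡.cong₂ _++_ (≡.trans (◃-◃ [ D ] UD p) (≡.sym (◃-◃ (D ∷ U ∷ []) [ D ] p)))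
                               (◃-· [ D ] k p)) ⟩
    (D ∷ U ∷ []) ◃ [ D ] ◃ p ++ k · [ D ] ◃ p
      ≈⟨ ∼-++ (DU-relation ([ D ] ◃ p)) ∼-refl ⟩
    (UD ◃ [ D ] ◃ p ++ [ D ] ◃ p) ++ k · [ D ] ◃ p
      ≈⟨ ≐⇒∼ (absorb (UD ◃ [ D ] ◃ p) ([ D ] ◃ p) k) ⟩
    θ+ (k + 1#) ([ D ] ◃ p) ∎
    where open ∼-Reasoning

  U◃Θ : ∀ f gs p → [ U ] ◃ Θ (λ g → f g + 1#) gs p ∼ Θ f gs ([ U ] ◃ p)
  U◃Θ f []       p = ∼-refl
  U◃Θ f (g ∷ gs) p = ∼-trans (U◃θ+ (f g) (Θ (λ g → f g + 1#) gs p)) (θ+-cong∼ (f g) (U◃Θ f gs p))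

  D◃Θ : ∀ f gs p → [ D ] ◃ Θ f gs p ∼ Θ (λ g → f g + 1#) gs ([ D ] ◃ p)
  D◃Θ f []       p = ∼-refl
  D◃Θ f (g ∷ gs) p = ∼-trans (D◃θ+ (f g) (Θ f gs p)) (θ+-cong∼ (f g + 1#) (D◃Θ f gs p))

  θ+-U^ : ∀ e k p → θ+ k (U^ e ◃ p) ∼ U^ e ◃ θ+ (k + ι e) p
  θ+-U^ zero    k p = begin
    θ+ k ([] ◃ p)       ≡⟨ ≡.cong (θ+ k) ([]◃ p) ⟩
    θ+ k p              ≈⟨ ≐⇒∼ (θ+-congˡ p (+-identityʳ k)) ⟨
    θ+ (k + 0#) p       ≡⟨ []◃ (θ+ (k + 0#) p) ⟨
    [] ◃ θ+ (k + 0#) p  ∎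
    where open ∼-Reasoning
  θ+-U^ (suc e) k p = begin
    θ+ k (U^ suc e ◃ p)               ≡⟨ ≡.cong (θ+ k) (◃-◃ [ U ] (U^ e) p) ⟨
    θ+ k ([ U ] ◃ U^ e ◃ p)           ≈⟨ U◃θ+ k (U^ e ◃ p) ⟨
    [ U ] ◃ θ+ (k + 1#) (U^ e ◃ p)    ≈⟨ ∼-◃ [ U ] (θ+-U^ e (k + 1#) p) ⟩
    [ U ] ◃ U^ e ◃ θ+ (k + 1# + ι e) p ≈⟨ ≐⇒∼ (◃-cong [ U ] (◃-cong (U^ e) (θ+-congˡ p (+-assoc k 1# _)))) ⟩
    [ U ] ◃ U^ e ◃ θ+ (k + ι (suc e)) p ≡⟨ ◃-◃ [ U ] (U^ e) _ ⟩
    U^ suc e ◃ θ+ (k + ι (suc e)) p   ∎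
    where open ∼-Reasoning

  D◃U^suc : ∀ e p → [ D ] ◃ U^ suc e ◃ p ∼ U^ e ◃ θ+ (1# + ι e) p
  D◃U^suc e p = begin
    [ D ] ◃ U^ suc e ◃ p        ≡⟨ ≡.trans (◃-◃ [ D ] (U^ suc e) p) (≡.sym (◃-◃ (D ∷ U ∷ []) (U^ e) p)) ⟩
    (D ∷ U ∷ []) ◃ U^ e ◃ p     ≈⟨ DU-relation (U^ e ◃ p) ⟩
    UD ◃ U^ e ◃ p ++ U^ e ◃ p   ≈⟨ ≐⇒∼ (++-cong≐ ≐-refl (·-identity (U^ e ◃ p))) ⟨
    θ+ 1# (U^ e ◃ p)            ≈⟨ θ+-U^ e 1# p ⟩
    U^ e ◃ θ+ (1# + ι e) p      ∎
    where open ∼-Reasoning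

  shift : ℕ → ℕ → Carrier
  shift d g = ι g - ι d

  shift-suc-suc : ∀ d g → shift (suc d) (suc g) ≈ shift d g
  shift-suc-suc d g = begin
    (1# + ι g) - (1# + ι d)       ≈⟨ +-congˡ (-‿+-comm 1# (ι d)) ⟨
    (1# + ι g) + (- 1# + - ι d)   ≈⟨ +-CS.interchange 1# (ι g) (- 1#) (- ι d) ⟩
    (1# - 1#) + (ι g - ι d)       ≈⟨ +-congʳ (-‿inverseʳ 1#) ⟩
    0# + (ι g - ι d)              ≈⟨ +-identityˡ _ ⟩
    ι g - ι d                     ∎
    where open ≈-Reasoning

  shift-sucʳ : ∀ d g → shift d (suc g) ≈ shift d g + 1#
  shift-sucʳ d g = +-CS.xy∙z≈yz∙x 1# (ι g) (- ι d)

  shift-sucˡ : ∀ d g → shift d g ≈ shift (suc d) g + 1#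
  shift-sucˡ d g = trans (sym (shift-suc-suc d g)) (shift-sucʳ (suc d) g)

  shift-self : ∀ d → shift d d ≈ 0#
  shift-self d = -‿inverseʳ (ι d)

  θ+-zero : ∀ {k} v → k ≈ 0# → θ+ k ⟦ v ⟧ ≐ ⟦ U ∷ D ∷ v ⟧
  θ+-zero {k} v k≈0 = mk≐ λ w →
    trans (coeff-θ+ w k ⟦ v ⟧) (trans (+-congˡ (trans (*-congʳ k≈0) (zeroˡ _))) (+-identityʳ _))

  U◃Θ-D∷ : ∀ u gs v → [ U ] ◃ Θ (shift u) gs ⟦ D ∷ v ⟧ ∼ Θ (shift (suc u)) (gs ∷ʳ suc u) ⟦ v ⟧
  U◃Θ-D∷ u gs v = begin
    [ U ] ◃ Θ (shift u) gs ⟦ D ∷ v ⟧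
      ≈⟨ ≐⇒∼ (◃-cong [ U ] (Θ-cong-fun (shift-sucˡ u) gs _)) ⟩
    [ U ] ◃ Θ (λ g → shift (suc u) g + 1#) gs ⟦ D ∷ v ⟧
      ≈⟨ U◃Θ (shift (suc u)) gs _ ⟩
    Θ (shift (suc u)) gs ⟦ U ∷ D ∷ v ⟧
      ≈⟨ Θ-cong∼ (shift (suc u)) gs (≐⇒∼ (θ+-zero v (shift-self (suc u)))) ⟨
    Θ (shift (suc u)) gs (θ+ (shift (suc u) (suc u)) ⟦ v ⟧)
      ≡⟨ Θ-∷ʳ (shift (suc u)) gs (suc u) ⟦ v ⟧ ⟨
    Θ (shift (suc u)) (gs ∷ʳ suc u) ⟦ v ⟧ ∎
    where open ∼-Reasoning

  D◃Θ-shift : ∀ u gs v → [ D ] ◃ Θ (shift u) gs ⟦ v ⟧ ∼ Θ (shift u) (map suc gs) ⟦ D ∷ v ⟧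
  D◃Θ-shift u gs v = begin
    [ D ] ◃ Θ (shift u) gs ⟦ v ⟧                  ≈⟨ D◃Θ (shift u) gs ⟦ v ⟧ ⟩
    Θ (λ g → shift u g + 1#) gs ⟦ D ∷ v ⟧         ≈⟨ ≐⇒∼ (Θ-cong-fun (λ g → sym (shift-sucʳ u g)) gs _) ⟩
    Θ (λ g → shift u (suc g)) gs ⟦ D ∷ v ⟧        ≡⟨ Θ-map (shift u) suc gs _ ⟨
    Θ (shift u) (map suc gs) ⟦ D ∷ v ⟧            ∎
    where open ∼-Reasoning

  range : ℕ → ℕ → List ℕ
  range a zero    = []
  range a (suc n) = a ∷ range (suc a) n

  map-suc-range : ∀ a n → map suc (range a n) ≡ range (suc a) n
  map-suc-range a zero    = ≡.refl
  map-suc-range a (suc n) = ≡.cong (suc a ∷_) (map-suc-range (suc a) n)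

  -- The normal form of a word in W, with θ = UD: a word with at least as many U as D is
  -- U^e ∏ (θ + g - #D) over its heights g; otherwise its e + 1 largest heights are traded
  -- for D^(e+1) on the right.
  data NormalForm (w : Word) : Set (c ⊔ ℓ) where
    moreU : ∀ e → countU w ≡ e Nat.+ countD w → ∀ gs → gs ↭ heights w →
            ⟦ w ⟧ ∼ U^ e ◃ Θ (shift (countD w)) gs ⟦ [] ⟧ → NormalForm w
    moreD : ∀ e → countD w ≡ suc e Nat.+ countU w →
            ∀ gs → heights w ↭ range (suc (countU w)) (suc e) ++ gs →
            ⟦ w ⟧ ∼ Θ (shift (countU w)) gs ⟦ D^ suc e ⟧ → NormalForm w

  U∷-normalForm : ∀ {x} → NormalForm x → NormalForm (U ∷ x)
  U∷-normalForm {x} (moreU e u≡ gs p s) = moreU (suc e) (≡.cong suc u≡) gs p (begin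
    ⟦ U ∷ x ⟧                                          ≈⟨ ∼-◃ [ U ] s ⟩
    [ U ] ◃ U^ e ◃ Θ (shift (countD x)) gs ⟦ [] ⟧        ≡⟨ ◃-◃ [ U ] (U^ e) _ ⟩
    U^ suc e ◃ Θ (shift (countD x)) gs ⟦ [] ⟧            ∎)
    where open ∼-Reasoning
  U∷-normalForm {x} (moreD zero d≡ gs p s) = moreU 0 (≡.sym d≡) (gs ∷ʳ countD x) p′ (begin
    ⟦ U ∷ x ⟧                                                        ≈⟨ ∼-◃ [ U ] s ⟩
    [ U ] ◃ Θ (shift (countU x)) gs ⟦ D ∷ [] ⟧                         ≈⟨ U◃Θ-D∷ (countU x) gs [] ⟩
    Θ (shift (suc (countU x))) (gs ∷ʳ suc (countU x)) ⟦ [] ⟧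
                                                  ≡⟨ ≡.cong (λ d → Θ (shift d) (gs ∷ʳ d) ⟦ [] ⟧) d≡ ⟨
    Θ (shift (countD x)) (gs ∷ʳ countD x) ⟦ [] ⟧                      ≡⟨ []◃ _ ⟨
    [] ◃ Θ (shift (countD x)) (gs ∷ʳ countD x) ⟦ [] ⟧                 ∎)
    where
    open ∼-Reasoning
    p′ : gs ∷ʳ countD x ↭ heights x
    p′ = ↭-trans (↭-sym (↭ₚ.∷↭∷ʳ (countD x) gs)) (↭-sym (≡.subst (λ d → heights x ↭ d ∷ gs) (≡.sym d≡) p))
  U∷-normalForm {x} (moreD (suc e) d≡ gs p s) =
    moreD e (≡.trans d≡ (≡.sym (ℕₚ.+-suc (suc e) (countU x)))) (gs ∷ʳ suc (countU x)) p′
          (∼-trans (∼-◃ [ U ] s) (U◃Θ-D∷ (countU x) gs (D^ suc e)))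
    where
    p′ : heights x ↭ range (suc (suc (countU x))) (suc e) ++ gs ∷ʳ suc (countU x)
    p′ = ↭-trans p (↭-trans (↭ₚ.∷↭∷ʳ (suc (countU x)) _)
                            (↭-reflexive (Listₚ.++-assoc (range (suc (suc (countU x))) (suc e)) gs _)))

  shift-excess : ∀ {d u e} → u ≡ suc e Nat.+ d → shift (suc d) (suc u) ≈ 1# + ι e
  shift-excess {d} {u} {e} u≡ = begin
    shift (suc d) (suc u)        ≈⟨ shift-suc-suc d u ⟩
    ι u - ι d                    ≈⟨ +-congʳ (trans (reflexive (≡.cong ι u≡)) (ι-+ (suc e) d)) ⟩
    ι (suc e) + ι d - ι d        ≈⟨ //-rightDividesʳ (ι d) (ι (suc e)) ⟩
    1# + ι e                     ∎
    where open ≈-Reasoning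

  D∷-normalForm : ∀ {x} → NormalForm x → NormalForm (D ∷ x)
  D∷-normalForm {x} (moreU zero u≡ gs p s) =
    moreD 0 (≡.cong suc (≡.sym u≡)) (map suc gs) (prep _ (↭ₚ.map⁺ suc (↭-sym p))) (begin
      ⟦ D ∷ x ⟧                                          ≈⟨ ∼-◃ [ D ] s ⟩
      [ D ] ◃ [] ◃ Θ (shift (countD x)) gs ⟦ [] ⟧          ≡⟨ ≡.cong ([ D ] ◃_) ([]◃ _) ⟩
      [ D ] ◃ Θ (shift (countD x)) gs ⟦ [] ⟧               ≈⟨ D◃Θ-shift (countD x) gs [] ⟩
      Θ (shift (countD x)) (map suc gs) ⟦ D ∷ [] ⟧
                                            ≡⟨ ≡.cong (λ d → Θ (shift d) (map suc gs) ⟦ D ∷ [] ⟧) u≡ ⟨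
      Θ (shift (countU x)) (map suc gs) ⟦ D ∷ [] ⟧         ∎)
    where open ∼-Reasoning
  D∷-normalForm {x} (moreU (suc e) u≡ gs p s) =
    moreU e (≡.trans u≡ (≡.sym (ℕₚ.+-suc e (countD x)))) (suc (countU x) ∷ map suc gs)
          (prep _ (↭ₚ.map⁺ suc p)) (begin
      ⟦ D ∷ x ⟧                 ≈⟨ ∼-◃ [ D ] s ⟩
      [ D ] ◃ U^ suc e ◃ Y      ≈⟨ D◃U^suc e Y ⟩
      U^ e ◃ θ+ (1# + ι e) Y    ≈⟨ ≐⇒∼ (◃-cong (U^ e) (≐-trans (θ+-congˡ Y new-factor) (θ+-cong _ Y≐))) ⟩
      U^ e ◃ Θ (shift (suc (countD x))) (suc (countU x) ∷ map suc gs) ⟦ [] ⟧ ∎)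
    where
    open ∼-Reasoning
    Y = Θ (shift (countD x)) gs ⟦ [] ⟧
    new-factor : 1# + ι e ≈ shift (suc (countD x)) (suc (countU x))
    new-factor = sym (shift-excess {countD x} {countU x} {e} u≡)
    Y≐ : Y ≐ Θ (shift (suc (countD x))) (map suc gs) ⟦ [] ⟧
    Y≐ = ≐-trans (Θ-cong-fun (λ g → sym (shift-suc-suc (countD x) g)) gs _)
                 (≡⇒≐ (≡.sym (Θ-map _ suc gs _)))
  D∷-normalForm {x} (moreD e d≡ gs p s) =
    moreD (suc e) (≡.cong suc d≡) (map suc gs) p′
          (∼-trans (∼-◃ [ D ] s) (D◃Θ-shift (countU x) gs (D^ suc e)))
    where
    p′ : heights (D ∷ x) ↭ range (suc (countU x)) (suc (suc e)) ++ map suc gs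
    p′ = prep _ (↭-trans (↭ₚ.map⁺ suc p) (↭-reflexive
           (≡.trans (Listₚ.map-++ suc (range (suc (countU x)) (suc e)) gs)
                    (≡.cong (_++ map suc gs) (map-suc-range (suc (countU x)) (suc e))))))

  normalForm : ∀ w → NormalForm w
  normalForm []      = moreU 0 ≡.refl [] ↭-refl ∼-refl
  normalForm (U ∷ w) = U∷-normalForm (normalForm w)
  normalForm (D ∷ w) = D∷-normalForm (normalForm w)

  moreD-contradiction : ∀ {d u e} → d ≡ suc e Nat.+ u → d ≤ u → ⊥
  moreD-contradiction {u = u} {e} d≡ d≤u = ℕₚ.<⇒≱ (s≤s (ℕₚ.m≤n+m u e)) (≡.subst (_≤ u) d≡ d≤u)

  sameHeights⇒∼ : ∀ {u v} → countU u ≡ countU v → countD u ≡ countD v → countD u ≤ countU u →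
    heights u ↭ heights v → ⟦ u ⟧ ∼ ⟦ v ⟧
  sameHeights⇒∼ {u} {v} u≡ d≡ d≤u u↭v with normalForm u | normalForm v
  ... | moreD e d≡′ _ _ _ | _ = ⊥-elim (moreD-contradiction d≡′ d≤u)
  ... | moreU _ _ _ _ _ | moreD e d≡′ _ _ _ = ⊥-elim (moreD-contradiction d≡′ (≡.subst₂ _≤_ d≡ u≡ d≤u))
  ... | moreU e u≡e+d gs p s | moreU e′ u≡e′+d′ gs′ p′ s′ = begin
    ⟦ u ⟧                                          ≈⟨ s ⟩
    U^ e ◃ Θ (shift (countD u)) gs ⟦ [] ⟧
      ≈⟨ ≐⇒∼ (◃-cong (U^ e) (Θ-↭ _ ⟦ [] ⟧ (↭-trans p (↭-trans u↭v (↭-sym p′))))) ⟩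
    U^ e ◃ Θ (shift (countD u)) gs′ ⟦ [] ⟧
      ≡⟨ ≡.cong₂ (λ e d → U^ e ◃ Θ (shift d) gs′ ⟦ [] ⟧) e≡e′ d≡ ⟩
    U^ e′ ◃ Θ (shift (countD v)) gs′ ⟦ [] ⟧         ≈⟨ s′ ⟨
    ⟦ v ⟧                                          ∎
    where
    open ∼-Reasoning
    e≡e′ : e ≡ e′
    e≡e′ = ℕₚ.+-cancelʳ-≡ (countD u) e e′
             (≡.trans (≡.sym u≡e+d) (≡.trans u≡ (≡.trans u≡e′+d′ (≡.cong (e′ Nat.+_) (≡.sym d≡)))))

module Classification {c ℓ} (R : CommutativeRing c ℓ) (char0 : CharZero R) where
  open ≡ using (refl; sym; trans)
  open ListProperties
  open Words
  open CanonicalWords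
  open CanonicalHeights
  open Canonicalisation
  open FreeAlgebra R using (∼⇒WeylEq)
  open Invariant R using (WeylEq⇒heights↭)
  open NormalForm R using (sameHeights⇒∼)

  canonicals-inequivalent : ∀ m k → k ≤ m → AllPairs (λ u v → ¬ WeylEq R u v) (canonicals m k)
  canonicals-inequivalent m k k≤m = allPairs-restrict (canonicals-counts m k)
    (λ {u} {v} (_ , u≡) (_ , v≡) differ u~v →
       differ (WeylEq⇒heights↭ char0 {u} {v} (trans u≡ (sym v≡)) u~v))
    (canonicals-distinct m k k≤m)

  canonicals-complete : ∀ {m k} w → countU w ≡ m → countD w ≡ k → k ≤ m →
    Any (WeylEq R w) (canonicals m k)
  canonicals-complete w refl refl d≤u with canonicalise (countD w) w refl d≤u
  ... | r , c , r↭w =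
    Any.map (λ { refl → ∼⇒WeylEq (sameHeights⇒∼ (sym u≡) (sym d≡) d≤u (↭-sym r↭w)) }) (∈-canonicals⁺ c)
    where
    u≡ = proj₁ (canonical-counts c)
    d≡ = proj₂ (canonical-counts c)

open import Data.Nat using (_+_; _*_)
open import Data.Nat.Combinatorics using (_C_)
open Words
open CanonicalWords

corollary6p5 : {c ℓ : Level} (R : CommutativeRing c ℓ) → IsField R → CharZero R →
    (n k : ℕ) → 2 * k ≤ n →
    ClassCount R n k (sum (map (λ j → (k ∸ j + 1) * ((n ∸ k ∸ 1) C j)) (upTo (suc k))))
corollary6p5 R _ char0 n k 2k≤n =
  canonicals (n ∸ k) k , length-canonicals (n ∸ k) k ,
  All.map (λ {w} → counts⇒HasType w k≤n) (canonicals-counts (n ∸ k) k) ,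
  canonicals-inequivalent (n ∸ k) k k≤n∸k ,
  λ w (len≡ , d≡) → canonicals-complete w (HasType⇒countU w len≡ d≡) d≡ k≤n∸k
  where
  open Classification R char0
  k≤n : k ≤ n
  k≤n = ℕₚ.≤-trans (ℕₚ.m≤m+n k (k + 0)) 2k≤n
  k≤n∸k : k ≤ n ∸ k
  k≤n∸k = ≡.subst (_≤ n ∸ k) (ℕₚ.m+n∸n≡m k k)
                  (ℕₚ.∸-monoˡ-≤ k (≡.subst (_≤ n) (≡.cong (k +_) (ℕₚ.+-identityʳ k)) 2k≤n))
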